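{- For every tree $T$, \[\rho(T)=\max_{v\in V(T)}\left\lfloor \frac{\ell_3(v)}{2}\right\rfloor.\]
   Context: Patrol game with radius of capture $\rho\ge 0$ on a connected graph $G$: there is one cop and one robber. Before the game the cop fixes a walk in $G$ (his patrol: a sequence of vertices in which consecutive vertices are equal or adjacent), and the robber knows the entire patrol in advance, while the cop has no information about the robber. The cop starts at the first vertex of his patrol, then the robber chooses a starting vertex; afterwards the players alternate moves (cop first), the cop following his patrol and the robber moving to an adjacent vertex or staying put. The cop wins if at some moment the distance between the cop and the robber is at most $\rho$; otherwise the robber wins. $\rho(G)$ is the minimum $\rho\ge0$ for which the cop has a patrol capturing the robber regardless of the robber's play. A triod is a tree with exactly three leaves and a unique vertex of degree three, its origin; for a triod $T'$, $\ell_3(T')$ is the distance from the origin to the closest of the three leaves. For a graph $G$ and a vertex $v$ of degree at least $3$, $\ell_3(v)$ is the maximum of $\ell_3(T')$ over all induced subgraphs $T'$ of $G$ that are triods with origin $v$; if $v$ has degree less than $3$, $\ell_3(v)=0$. -}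

module Defs where

open import Data.Bool using (Bool; true; false; _∧_; if_then_else_)
open import Data.Nat using (ℕ; zero; suc; _+_; _≤_; _<_; _⊓_; _/_)
open import Data.Fin using (Fin; zero; suc; inject₁; fromℕ)
open import Data.List using (List; map; allFin)
open import Data.Nat.ListAction using (sum)
open import Data.Product using (Σ; ∃; _×_; _,_)
open import Data.Sum using (_⊎_)
open import Relation.Nullary using (¬_)
open import Relation.Binary.PropositionalEquality using (_≡_; _≢_)
open import Function.Definitions using (Injective)

record Graph : Set where
  field
    n     : ℕ
    adj   : Fin n → Fin n → Bool
    sym   : ∀ u w → adj u w ≡ adj w u
    irref : ∀ u → adj u u ≡ false

module _ (G : Graph) where
  open Graph G

  V : Set
  V = Fin n

  -- vertex subsets (induced subgraphs G[S])
  VSet : Set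
  VSet = V → Bool

  full : VSet
  full _ = true

  data Walk (S : VSet) : V → V → ℕ → Set where
    here : ∀ {u} → S u ≡ true → Walk S u u 0
    step : ∀ {u w x k} → S u ≡ true → adj u w ≡ true →
           Walk S w x k → Walk S u x (suc k)

  Dist : VSet → V → V → ℕ → Set
  Dist S u w d = Walk S u w d × (∀ k → Walk S u w k → d ≤ k)

  deg : VSet → V → ℕ
  deg S v = sum (map (λ u → if S u ∧ adj v u then 1 else 0) (allFin n))

  Nonempty : VSet → Set
  Nonempty S = ∃ λ v → S v ≡ true

  Connected : VSet → Set
  Connected S = ∀ u w → S u ≡ true → S w ≡ true → ∃ λ k → Walk S u w k

  Cycle : VSet → Set
  Cycle S = Σ ℕ λ m → Σ (Fin (3 + m) → V) λ c →
              Injective _≡_ _≡_ c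
            × (∀ i → S (c i) ≡ true)
            × (∀ (i : Fin (2 + m)) → adj (c (inject₁ i)) (c (suc i)) ≡ true)
            × adj (c (fromℕ (2 + m))) (c zero) ≡ true

  IsTreeOn : VSet → Set
  IsTreeOn S = Nonempty S × Connected S × ¬ Cycle S

  Leaf : VSet → V → Set
  Leaf S x = S x ≡ true × deg S x ≡ 1

  IsTriod : VSet → V → V → V → V → Set
  IsTriod S v a b c =
      S v ≡ true
    × IsTreeOn S
    × deg S v ≡ 3
    × (∀ u → S u ≡ true → deg S u ≡ 3 → u ≡ v)
    × Leaf S a × Leaf S b × Leaf S c
    × a ≢ b × a ≢ c × b ≢ c
    × (∀ u → Leaf S u → u ≡ a ⊎ u ≡ b ⊎ u ≡ c)

  TriodL3 : VSet → V → ℕ → Set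
  TriodL3 S v k = Σ V λ a → Σ V λ b → Σ V λ c → IsTriod S v a b c ×
                  Σ ℕ λ da → Σ ℕ λ db → Σ ℕ λ dc →
                  Dist S v a da × Dist S v b db × Dist S v c dc ×
                  k ≡ da ⊓ db ⊓ dc

  IsL3 : V → ℕ → Set
  IsL3 v k =
      (deg full v < 3 × k ≡ 0)
    ⊎ (3 ≤ deg full v
       × (∃ λ S → TriodL3 S v k)
       × (∀ S k' → TriodL3 S v k' → k' ≤ k))

  IsMaxHalfL3 : ℕ → Set
  IsMaxHalfL3 M = (∀ v k → IsL3 v k → k / 2 ≤ M)
                × (∃ λ v → ∃ λ k → IsL3 v k × M ≡ k / 2)

  -- Patrol game.  A (finite) walk with m moves is given by positions
  -- p 0, ..., p m (values beyond m are irrelevant).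
  IsLazyWalk : ℕ → (ℕ → V) → Set
  IsLazyWalk m p = ∀ i → i < m → p i ≡ p (suc i) ⊎ adj (p i) (p (suc i)) ≡ true

  Close : ℕ → V → V → Set
  Close ρ u w = ∃ λ k → k ≤ ρ × Walk full u w k

  -- Positions during the game: (p0,r0), (p1,r0), (p1,r1), (p2,r1), ..., (pm,rm)
  Captures : ℕ → ℕ → (ℕ → V) → (ℕ → V) → Set
  Captures ρ m p r = (∃ λ i → i ≤ m × Close ρ (p i) (r i))
                   ⊎ (∃ λ i → i < m × Close ρ (p (suc i)) (r i))

  CopWins : ℕ → Set
  CopWins ρ = ∃ λ m → ∃ λ p → IsLazyWalk m p ×
              (∀ r → IsLazyWalk m r → Captures ρ m p r)

  RhoIs : ℕ → Set
  RhoIs M = CopWins M × (∀ ρ → CopWins ρ → M ≤ ρ)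

  IsTree : Set
  IsTree = IsTreeOn full

-- Writing ℓ₃(v) ≥ k + 1 as "three neighbours of v start non-backtracking rays of length k away
-- from v", the value M = max ⌊ℓ₃/2⌋ says that some vertex has three legs of length 2ρ + 2 exactly
-- when ρ < M (an induced triod is the union of its legs, and the geodesics from its origin to its
-- leaves leave through distinct neighbours).
--
-- Robber: given three legs of length 2ρ + 2 at v, he hides on a leg other than those whose leaves
-- the cop was last and will next be within ρ of, at a depth bounded by the time since and until
-- those moments (and at v at those moments). Two leaves are 2(2ρ + 2) apart, so the cop never gets
-- within ρ of him.
--
-- Cop: without such legs every subtree hanging off a longest path has depth at most 2ρ. The cop
-- walks along a longest path and at each of its vertices tours the hanging subtrees down to depth ρ.
-- A robber in a hanging subtree can only leave it through the path vertex, where he would be caught,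
-- so he is caught during the tour; a robber further along the path can never pass the cop.

module Submission where

open import Defs
open import Data.Bool using (Bool; true; false; _∧_; not; if_then_else_)
open import Data.Bool.Properties using (∧-conicalˡ; ∧-conicalʳ; ∧-identityʳ; ∧-zeroʳ) renaming (_≟_ to _≟ᵇ_)
open import Data.Empty using (⊥; ⊥-elim)
open import Data.Fin using (Fin; zero; suc; toℕ; inject₁; fromℕ; fromℕ<) renaming (_<_ to _<ᶠ_)
open import Data.Fin.Properties
  using (toℕ-injective; toℕ-inject₁; toℕ-fromℕ; toℕ-fromℕ<; toℕ<n; any?; pigeonhole; injective⇒≤)
  renaming (_≟_ to _≟ᵛ_; suc-injective to Fin-suc-injective)
open import Data.List using (List; []; _∷_; map; tabulate; allFin; length; lookup; filter)
open import Data.List.Membership.Propositional using (_∈_; _∉_)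
open import Data.List.Membership.Propositional.Properties using (∈-lookup; ∈-allFin; ∈-filter⁺; ∈-filter⁻)
open import Data.List.Relation.Unary.All using (All; []; _∷_)
import Data.List.Relation.Unary.All as All
open import Data.List.Relation.Unary.All.Properties using (¬Any⇒All¬)
open import Data.List.Relation.Unary.Any using (here; there)
import Data.List.Relation.Unary.Any as Any
open import Data.List.Relation.Unary.AllPairs using ([]; _∷_)
open import Data.List.Relation.Unary.Unique.Propositional using (Unique)
open import Data.List.Extrema.Nat using (argmax; f[xs]≤f[argmax])
open import Data.Maybe using (Maybe; just; nothing)
open import Data.Nat
open import Data.Nat.DivMod using (m*n/n≡m; m/n*n≤m; /-monoˡ-≤)
open import Data.Nat.ListAction using (sum)
open import Data.Nat.Properties
open import Data.Nat.Tactic.RingSolver using (solve-∀)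
open import Data.Product using (Σ; ∃; _×_; _,_; proj₁; proj₂)
open import Data.Sum using (_⊎_; inj₁; inj₂)
open import Function using (_∘_)
open import Relation.Binary.Definitions using (Tri; tri<; tri≈; tri>)
open import Relation.Binary.PropositionalEquality
open import Relation.Nullary using (Dec; yes; no; ¬_)
open import Relation.Nullary.Decidable using (⌊_⌋; _×-dec_; _⊎-dec_; ¬?; decidable-stable)

≤-split : ∀ {a b} → a ≤ b → ∃ λ k → b ≡ a + k
≤-split {b = b} z≤n = b , refl
≤-split (s≤s le) with ≤-split le
... | k , eq = k , cong suc eq

2+2m≡[1+m]*2 : ∀ m → suc (suc (m + m)) ≡ suc m * 2
2+2m≡[1+m]*2 = solve-∀

2+2m≤n⇒m<n/2 : ∀ {m n} → suc (suc (m + m)) ≤ n → m < n / 2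
2+2m≤n⇒m<n/2 {m} {n} le = subst (_≤ n / 2) (m*n/n≡m (suc m) 2) (/-monoˡ-≤ 2 (subst (_≤ n) (2+2m≡[1+m]*2 m) le))

m<n/2⇒2+2m≤n : ∀ {m n} → m < n / 2 → suc (suc (m + m)) ≤ n
m<n/2⇒2+2m≤n {m} {n} lt = ≤-trans (≤-reflexive (2+2m≡[1+m]*2 m)) (≤-trans (*-monoˡ-≤ 2 lt) (m/n*n≤m n 2))

module _ {P : ℕ → Set} (P? : ∀ k → Dec (P k)) where

  private
    search : ∀ N → (∃ λ k → P k × (∀ j → j < k → ¬ P j)) ⊎ (∀ j → j < N → ¬ P j)
    search zero = inj₂ λ _ ()
    search (suc N) with search N
    ... | inj₁ found = inj₁ found
    ... | inj₂ none with P? N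
    ...   | yes pN = inj₁ (N , pN , none)
    ...   | no ¬pN = inj₂ below
      where
      below : ∀ j → j < suc N → ¬ P j
      below j j<1+N with m<1+n⇒m<n∨m≡n j<1+N
      ... | inj₁ j<N = none j j<N
      ... | inj₂ refl = ¬pN

  least : ∀ N → P N → ∃ λ k → P k × (∀ j → j < k → ¬ P j)
  least N pN with search (suc N)
  ... | inj₁ found = found
  ... | inj₂ none = ⊥-elim (none N ≤-refl pN)

  private
    greatest-≤ : ∀ B → P 0 → ∃ λ k → P k × (∀ j → P j → j ≤ B → j ≤ k)
    greatest-≤ zero p0 = 0 , p0 , λ _ _ j≤0 → j≤0
    greatest-≤ (suc B) p0 with P? (suc B)
    ... | yes pB = suc B , pB , λ _ _ j≤1+B → j≤1+B
    ... | no ¬pB with greatest-≤ B p0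
    ... | k , pk , max = k , pk , below
      where
      below : ∀ j → P j → j ≤ suc B → j ≤ k
      below j pj j≤1+B with m≤n⇒m<n∨m≡n j≤1+B
      ... | inj₁ (s≤s j≤B) = max j pj j≤B
      ... | inj₂ refl = ⊥-elim (¬pB pj)

  greatest : ∀ B → P 0 → (∀ j → P j → j ≤ B) → ∃ λ k → P k × (∀ j → P j → j ≤ k)
  greatest B p0 bound with greatest-≤ B p0
  ... | k , pk , max = k , pk , λ j pj → max j pj (bound j pj)

∑ : ∀ m → (Fin m → ℕ) → ℕ
∑ zero g = 0
∑ (suc m) g = g zero + ∑ m (g ∘ suc)

∑-mono-≤ : ∀ m {g h : Fin m → ℕ} → (∀ i → g i ≤ h i) → ∑ m g ≤ ∑ m h
∑-mono-≤ zero le = z≤n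
∑-mono-≤ (suc m) le = +-mono-≤ (le zero) (∑-mono-≤ m (le ∘ suc))

∑-+ : ∀ m (g h : Fin m → ℕ) → ∑ m (λ i → g i + h i) ≡ ∑ m g + ∑ m h
∑-+ zero g h = refl
∑-+ (suc m) g h = begin
  g zero + h zero + ∑ m (λ i → g (suc i) + h (suc i))  ≡⟨ cong (g zero + h zero +_) (∑-+ m (g ∘ suc) (h ∘ suc)) ⟩
  g zero + h zero + (∑ m (g ∘ suc) + ∑ m (h ∘ suc))    ≡⟨ +-assoc-swap (g zero) (h zero) _ _ ⟩
  g zero + ∑ m (g ∘ suc) + (h zero + ∑ m (h ∘ suc))    ∎
  where
  open ≡-Reasoning
  +-assoc-swap : ∀ a b c d → a + b + (c + d) ≡ a + c + (b + d)
  +-assoc-swap = solve-∀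

∑-cong : ∀ m {g h : Fin m → ℕ} → (∀ i → g i ≡ h i) → ∑ m g ≡ ∑ m h
∑-cong zero eq = refl
∑-cong (suc m) eq = cong₂ _+_ (eq zero) (∑-cong m (eq ∘ suc))

∑-zero : ∀ m → ∑ m (λ _ → 0) ≡ 0
∑-zero zero = refl
∑-zero (suc m) = ∑-zero m

sum-map-tabulate : ∀ {X : Set} m (h : X → ℕ) (k : Fin m → X) → sum (map h (tabulate k)) ≡ ∑ m (h ∘ k)
sum-map-tabulate zero h k = refl
sum-map-tabulate (suc m) h k = cong (h (k zero) +_) (sum-map-tabulate m h (k ∘ suc))

indicator : Bool → ℕ
indicator b = if b then 1 else 0

point : ∀ {m} → Fin m → Fin m → ℕ
point a i = indicator ⌊ i ≟ᵛ a ⌋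

∑-point : ∀ m (a : Fin m) → ∑ m (point a) ≡ 1
∑-point (suc m) zero = cong suc (∑-zero m)
∑-point (suc m) (suc a) = trans (∑-cong m point-suc) (∑-point m a)
  where
  point-suc : ∀ i → point (suc a) (suc i) ≡ point a i
  point-suc i with suc i ≟ᵛ suc a | i ≟ᵛ a
  ... | yes _ | yes _ = refl
  ... | no _ | no _ = refl
  ... | yes e | no ne = ⊥-elim (ne (Fin-suc-injective e))
  ... | no ne | yes refl = ⊥-elim (ne refl)

count : ∀ {m} → (Fin m → Bool) → ℕ
count {m} f = ∑ m (indicator ∘ f)

_∖_ : ∀ {m} → (Fin m → Bool) → Fin m → Fin m → Bool
(f ∖ a) i = f i ∧ not ⌊ i ≟ᵛ a ⌋

∖-self : ∀ {m} (f : Fin m → Bool) a → (f ∖ a) a ≢ true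
∖-self f a with a ≟ᵛ a
... | yes _ rewrite ∧-zeroʳ (f a) = λ ()
... | no a≢a = ⊥-elim (a≢a refl)

∖-intro : ∀ {m} (f : Fin m → Bool) {a i} → f i ≡ true → i ≢ a → (f ∖ a) i ≡ true
∖-intro f {a} {i} fi i≢a with i ≟ᵛ a
... | yes i≡a = ⊥-elim (i≢a i≡a)
... | no _ = trans (∧-identityʳ (f i)) fi

∑-split : ∀ {m} (f : Fin m → Bool) a → ∑ m (λ i → point a i + indicator ((f ∖ a) i)) ≡ suc (count (f ∖ a))
∑-split {m} f a = trans (∑-+ m (point a) _) (cong (_+ count (f ∖ a)) (∑-point m a))

count-remove-≤ : ∀ {m} (f : Fin m → Bool) a → count f ≤ suc (count (f ∖ a))
count-remove-≤ {m} f a = ≤-trans (∑-mono-≤ m pointwise) (≤-reflexive (∑-split f a))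
  where
  pointwise : ∀ i → indicator (f i) ≤ point a i + indicator ((f ∖ a) i)
  pointwise i with f i | i ≟ᵛ a
  ... | false | _ = z≤n
  ... | true | yes _ = s≤s z≤n
  ... | true | no _ = ≤-refl

count-remove : ∀ {m} (f : Fin m → Bool) {a} → f a ≡ true → count f ≡ suc (count (f ∖ a))
count-remove {m} f {a} fa = trans (∑-cong m pointwise) (∑-split f a)
  where
  pointwise : ∀ i → indicator (f i) ≡ point a i + indicator ((f ∖ a) i)
  pointwise i with i ≟ᵛ a
  ... | yes refl rewrite fa = refl
  ... | no _ = cong indicator (sym (∧-identityʳ (f i)))

count-≤-length : ∀ {m} (f : Fin m → Bool) xs → (∀ i → f i ≡ true → i ∈ xs) → count f ≤ length xs
count-≤-length {m} f [] none = ≤-trans (∑-mono-≤ m pointwise) (≤-reflexive (∑-zero m))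
  where
  pointwise : ∀ i → indicator (f i) ≤ 0
  pointwise i with f i in fi
  ... | true with () ← none i fi
  ... | false = z≤n
count-≤-length f (x ∷ xs) covered = ≤-trans (count-remove-≤ f x) (s≤s (count-≤-length (f ∖ x) xs covered∖x))
  where
  covered∖x : ∀ i → (f ∖ x) i ≡ true → i ∈ xs
  covered∖x i e with covered i (∧-conicalˡ (f i) _ e)
  ... | here refl = ⊥-elim (∖-self f i e)
  ... | there i∈xs = i∈xs

length-≤-count : ∀ {m} (f : Fin m → Bool) {xs} → Unique xs → All (λ i → f i ≡ true) xs → length xs ≤ count f
length-≤-count f [] [] = z≤n
length-≤-count f {x ∷ xs} (x≢xs ∷ unique) (fx ∷ fxs) =
  subst (suc (length xs) ≤_) (sym (count-remove f fx)) (s≤s (length-≤-count (f ∖ x) unique (remaining x≢xs fxs)))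
  where
  remaining : ∀ {ys} → All (x ≢_) ys → All (λ i → f i ≡ true) ys → All (λ i → (f ∖ x) i ≡ true) ys
  remaining [] [] = []
  remaining (x≢y ∷ x≢ys) (fy ∷ fys) = ∖-intro f fy (x≢y ∘ sym) ∷ remaining x≢ys fys

_∈?_ : ∀ {m} (i : Fin m) xs → Dec (i ∈ xs)
i ∈? xs = Any.any? (i ≟ᵛ_) xs

fresh-witness : ∀ {m} (f : Fin m → Bool) xs → length xs < count f → ∃ λ i → f i ≡ true × i ∉ xs
fresh-witness f xs lt with any? (λ i → (f i ≟ᵇ true) ×-dec ¬? (i ∈? xs))
... | yes found = found
... | no none = ⊥-elim (<⇒≱ lt (count-≤-length f xs covered))
  where
  covered : ∀ i → f i ≡ true → i ∈ xs
  covered i fi = decidable-stable (i ∈? xs) (λ i∉xs → none (i , fi , i∉xs))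

lookup-injective : ∀ {A : Set} {xs : List A} → Unique xs → ∀ i j → lookup xs i ≡ lookup xs j → i ≡ j
lookup-injective (_ ∷ _) zero zero _ = refl
lookup-injective (x≢xs ∷ _) zero (suc j) e = ⊥-elim (All.lookup x≢xs (∈-lookup j) e)
lookup-injective (x≢xs ∷ _) (suc i) zero e = ⊥-elim (All.lookup x≢xs (∈-lookup i) (sym e))
lookup-injective (_ ∷ unique) (suc i) (suc j) e = cong suc (lookup-injective unique i j e)

module _ (G : Graph) where

  open Graph G renaming (sym to adj-sym)

  Path : Set
  Path = ℕ → V G

  Adjacent : Path → ℕ → Set
  Adjacent f L = ∀ i → i < L → adj (f i) (f (suc i)) ≡ true

  NonBacktracking : Path → ℕ → Set
  NonBacktracking f L = ∀ i → 2 + i ≤ L → f i ≢ f (2 + i)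

  Inside : VSet G → Path → ℕ → Set
  Inside S f L = ∀ i → i ≤ L → S (f i) ≡ true

  Adjacent-≤ : ∀ f {L L′} → L′ ≤ L → Adjacent f L → Adjacent f L′
  Adjacent-≤ f le A i lt = A i (≤-trans lt le)

  NonBacktracking-≤ : ∀ f {L L′} → L′ ≤ L → NonBacktracking f L → NonBacktracking f L′
  NonBacktracking-≤ f le N i l = N i (≤-trans l le)

  Inside-≤ : ∀ {S} f {L L′} → L′ ≤ L → Inside S f L → Inside S f L′
  Inside-≤ f le I i l = I i (≤-trans l le)

  cons : V G → Path → Path
  cons u g zero = u
  cons u g (suc i) = g i

  shift : ℕ → Path → Path
  shift k f i = f (k + i)

  Adjacent-shift : ∀ f k {L} → Adjacent f (k + L) → Adjacent (shift k f) L
  Adjacent-shift f k A i lt =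
    subst (λ z → adj (f (k + i)) (f z) ≡ true) (sym (+-suc k i)) (A (k + i) (+-monoʳ-< k lt))

  NonBacktracking-shift : ∀ f k {L} → NonBacktracking f (k + L) → NonBacktracking (shift k f) L
  NonBacktracking-shift f k {L} N i le e =
    N (k + i) (subst (_≤ k + L) k+2+i (+-monoʳ-≤ k le)) (trans e (cong f k+2+i))
    where
    k+2+i : k + (2 + i) ≡ 2 + (k + i)
    k+2+i = trans (+-suc k (suc i)) (cong suc (+-suc k i))

  Inside-shift : ∀ {S} f k {L} → Inside S f (k + L) → Inside S (shift k f) L
  Inside-shift f k I i le = I (k + i) (+-monoʳ-≤ k le)

  append : Path → ℕ → Path → Path
  append f zero g = g
  append f (suc L) g = cons (f 0) (append (shift 1 f) L g)

  append-< : ∀ f L g i → i < L → append f L g i ≡ f i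
  append-< f (suc L) g zero _ = refl
  append-< f (suc L) g (suc i) (s≤s lt) = append-< (shift 1 f) L g i lt

  append-+ : ∀ f L g j → append f L g (L + j) ≡ g j
  append-+ f zero g j = refl
  append-+ f (suc L) g j = append-+ (shift 1 f) L g j

  append-≤ : ∀ f L g i → i ≤ L → f L ≡ g 0 → append f L g i ≡ f i
  append-≤ f L g i le join with m≤n⇒m<n∨m≡n le
  ... | inj₁ lt = append-< f L g i lt
  ... | inj₂ refl = trans (trans (cong (append f i g) (sym (+-identityʳ i))) (append-+ f i g 0)) (sym join)

  Adjacent-append : ∀ f L g L′ → Adjacent f L → Adjacent g L′ → f L ≡ g 0 → Adjacent (append f L g) (L + L′)
  Adjacent-append f zero g L′ Af Ag join = Ag
  Adjacent-append f (suc L) g L′ Af Ag join zero _ =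
    subst (λ z → adj (f 0) z ≡ true) (sym (append-≤ (shift 1 f) L g 0 z≤n join)) (Af 0 (s≤s z≤n))
  Adjacent-append f (suc L) g L′ Af Ag join (suc i) (s≤s lt) =
    Adjacent-append (shift 1 f) L g L′ (λ i lt → Af (suc i) (s≤s lt)) Ag join i lt

  StraightJoin : Path → ℕ → Path → ℕ → Set
  StraightJoin f L g L′ = ∀ a → L ≡ suc a → 1 ≤ L′ → f a ≢ g 1

  NonBacktracking-append : ∀ f L g L′ → NonBacktracking f L → NonBacktracking g L′ → f L ≡ g 0 →
                           StraightJoin f L g L′ → NonBacktracking (append f L g) (L + L′)
  NonBacktracking-append f zero g L′ Nf Ng join J = Ng
  NonBacktracking-append f (suc zero) g L′ Nf Ng join J zero (s≤s (s≤s le)) = J 0 refl (s≤s z≤n)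
  NonBacktracking-append f (suc (suc L)) g L′ Nf Ng join J zero le e =
    Nf 0 (s≤s (s≤s z≤n)) (trans e (append-≤ (shift 2 f) L g 0 z≤n join))
  NonBacktracking-append f (suc L) g L′ Nf Ng join J (suc i) (s≤s le) =
    NonBacktracking-append (shift 1 f) L g L′ (λ i le → Nf (suc i) (s≤s le)) Ng join
      (λ a e l → J (suc a) (cong suc e) l) i le

  Inside-append : ∀ {S} f L g L′ → Inside S f L → Inside S g L′ → f L ≡ g 0 → Inside S (append f L g) (L + L′)
  Inside-append f zero g L′ If Ig join = Ig
  Inside-append f (suc L) g L′ If Ig join zero _ = If 0 z≤n
  Inside-append {S} f (suc L) g L′ If Ig join (suc i) (s≤s le) =
    Inside-append {S} (shift 1 f) L g L′ (λ j l → If (suc j) (s≤s l)) Ig join i le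

  reverse : Path → ℕ → Path
  reverse f L i = f (L ∸ i)

  reverse-end : ∀ f L → reverse f L L ≡ f 0
  reverse-end f L = cong f (n∸n≡0 L)

  Adjacent-reverse : ∀ f L → Adjacent f L → Adjacent (reverse f L) L
  Adjacent-reverse f L A i lt with ≤-split lt
  ... | k , refl = subst₂ (λ a b → adj (f a) (f b) ≡ true)
                     (sym (trans (cong (_∸ i) (sym (+-suc i k))) (m+n∸m≡n i (suc k)))) (sym (m+n∸m≡n i k))
                     (trans (adj-sym _ _) (A k (s≤s (m≤n+m k i))))

  NonBacktracking-reverse : ∀ f L → NonBacktracking f L → NonBacktracking (reverse f L) L
  NonBacktracking-reverse f L N i le e with ≤-split le
  ... | k , refl = N k (+-monoˡ-≤ k (m≤m+n 2 i)) (sym (subst₂ (λ a b → f a ≡ f b) e₁ e₂ e))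
    where
    e₁ : 2 + i + k ∸ i ≡ 2 + k
    e₁ = trans (cong (λ z → suc (suc z) ∸ i) (+-comm i k)) (m+n∸n≡m (2 + k) i)
    e₂ : 2 + i + k ∸ (2 + i) ≡ k
    e₂ = m+n∸m≡n (2 + i) k

  edge : V G → V G → Path
  edge u w = cons u (λ _ → w)

  extend : Path → ℕ → V G → Path
  extend g a x = append g a (edge (g a) x)

  extend-≤ : ∀ g a x i → i ≤ a → extend g a x i ≡ g i
  extend-≤ g a x i le = append-≤ g a (edge (g a) x) i le refl

  extend-end : ∀ g a x → extend g a x (suc a) ≡ x
  extend-end g a x = trans (cong (extend g a x) (sym (+-comm a 1))) (append-+ g a (edge (g a) x) 1)

  Adjacent-extend : ∀ g a x → Adjacent g a → adj (g a) x ≡ true → Adjacent (extend g a x) (suc a)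
  Adjacent-extend g a x A ax = subst (Adjacent (extend g a x)) (+-comm a 1)
    (Adjacent-append g a (edge (g a) x) 1 A (λ { zero _ → ax ; (suc i) (s≤s ()) }) refl)

  NonBacktracking-extend : ∀ g a x → NonBacktracking g a → (∀ b → a ≡ suc b → g b ≢ x) →
                           NonBacktracking (extend g a x) (suc a)
  NonBacktracking-extend g a x N J = subst (NonBacktracking (extend g a x)) (+-comm a 1)
    (NonBacktracking-append g a (edge (g a) x) 1 N (λ { i (s≤s ()) }) refl (λ b e _ → J b e))

  Inside-extend : ∀ {S} g a x → Inside S g a → S x ≡ true → Inside S (extend g a x) (suc a)
  Inside-extend {S} g a x I sx = subst (Inside S (extend g a x)) (+-comm a 1)
    (Inside-append {S} g a (edge (g a) x) 1 I (λ { zero _ → I a ≤-refl ; (suc zero) _ → sx ; (suc (suc _)) (s≤s ()) }) refl)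

  walk→path : ∀ {S u w k} → Walk G S u w k →
              Σ Path λ f → f 0 ≡ u × f k ≡ w × Adjacent f k × Inside S f k
  walk→path (here {u} su) = (λ _ → u) , refl , refl , (λ i ()) , λ i _ → su
  walk→path (step {u} su a W) with walk→path W
  ... | g , g0 , gk , gA , gI = cons u g , refl , gk , A , I
    where
    A : Adjacent (cons u g) _
    A zero _ = subst (λ z → adj u z ≡ true) (sym g0) a
    A (suc i) (s≤s lt) = gA i lt
    I : Inside _ (cons u g) _
    I zero _ = su
    I (suc i) (s≤s le) = gI i le

  path→walk : ∀ {S} f L → Adjacent f L → Inside S f L → Walk G S (f 0) (f L) L
  path→walk f zero A I = here (I 0 z≤n)
  path→walk f (suc L) A I = step (I 0 z≤n) (A 0 (s≤s z≤n))
    (path→walk (shift 1 f) L (λ i lt → A (suc i) (s≤s lt)) (λ i le → I (suc i) (s≤s le)))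

  path→full-walk : ∀ f L → Adjacent f L → Walk G (full G) (f 0) (f L) L
  path→full-walk f L A = path→walk f L A (λ _ _ → refl)

  walk-++ : ∀ {S u w x k j} → Walk G S u w k → Walk G S w x j → Walk G S u x (k + j)
  walk-++ (here _) W = W
  walk-++ (step su a W₁) W = step su a (walk-++ W₁ W)

  walk-snoc : ∀ {S u w x k} → Walk G S u w k → S x ≡ true → adj w x ≡ true → Walk G S u x (suc k)
  walk-snoc (here su) sx a = step su a (here sx)
  walk-snoc (step su a W) sx b = step su a (walk-snoc W sx b)

  walk-reverse : ∀ {S u w k} → Walk G S u w k → Walk G S w u k
  walk-reverse (here su) = here su
  walk-reverse (step su a W) = walk-snoc (walk-reverse W) su (trans (adj-sym _ _) a)

  walk-full : ∀ {S u w k} → Walk G S u w k → Walk G (full G) u w k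
  walk-full (here _) = here refl
  walk-full (step _ a W) = step refl a (walk-full W)

  walk? : ∀ k u w → Dec (Walk G (full G) u w k)
  walk? zero u w with u ≟ᵛ w
  ... | yes refl = yes (here refl)
  ... | no u≢w = no λ { (here _) → u≢w refl }
  walk? (suc k) u w with any? (λ y → (adj u y ≟ᵇ true) ×-dec walk? k y w)
  ... | yes (y , a , W) = yes (step refl a W)
  ... | no none = no λ { (step {w = y} _ a W) → none (y , a , W) }

  shortest-walk : ∀ {u w k} → Walk G (full G) u w k → ∃ λ d → Dist G (full G) u w d
  shortest-walk {u} {w} {k} W with least (λ j → walk? j u w) k W
  ... | d , Wd , min = d , Wd , λ j Wj → ≮⇒≥ (λ j<d → min j j<d Wj)

  shortcut : ∀ {S} f L i → Adjacent f L → Inside S f L → 2 + i ≤ L → f i ≡ f (2 + i) →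
             ∃ λ L′ → L′ < L × Walk G S (f 0) (f L) L′
  shortcut {S} f L i A I le turn with ≤-split le
  ... | k , refl = i + k , s≤s (n≤1+n (i + k)) , W
    where
    i≤L : i ≤ 2 + i + k
    i≤L = ≤-trans (m≤n+m i 2) (m≤m+n (2 + i) k)
    join : f i ≡ shift (2 + i) f 0
    join = trans turn (cong f (sym (+-identityʳ (2 + i))))
    W : Walk G S (f 0) (f (2 + i + k)) (i + k)
    W = subst₂ (λ x y → Walk G S x y (i + k)) (append-≤ f i _ 0 z≤n join) (append-+ f i _ k)
          (path→walk (append f i (shift (2 + i) f)) (i + k)
            (Adjacent-append f i _ k (Adjacent-≤ f i≤L A) (Adjacent-shift f (2 + i) A) join)
            (Inside-append {S} f i _ k (Inside-≤ {S} f i≤L I) (Inside-shift {S} f (2 + i) I) join))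

  geodesic⇒NonBacktracking : ∀ {S} f L → Adjacent f L → Inside S f L →
                             (∀ j → Walk G S (f 0) (f L) j → L ≤ j) → NonBacktracking f L
  geodesic⇒NonBacktracking f L A I min i le turn with shortcut f L i A I le turn
  ... | L′ , lt , W = <⇒≱ lt (min L′ W)

  no-loop : ∀ u → adj u u ≢ true
  no-loop u loop with trans (sym loop) (irref u)
  ... | ()

  first-repeat : ∀ (f : Path) L → f 0 ≡ f (suc L) →
                 ∃ λ i → ∃ λ j → i < j × j ≤ suc L × f i ≡ f j × (∀ a b → a < b → b < j → f a ≢ f b)
  first-repeat f L closed = toℕ i , j , toℕ<n i , j≤L , fi≡fj , distinct
    where
    Repeats : ℕ → Set
    Repeats j = Σ (Fin j) λ i → f (toℕ i) ≡ f j
    repeats? : ∀ j → Dec (Repeats j)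
    repeats? j = any? (λ i → f (toℕ i) ≟ᵛ f j)
    first = least repeats? (suc L) (zero , closed)
    j = proj₁ first
    i = proj₁ (proj₁ (proj₂ first))
    fi≡fj = proj₂ (proj₁ (proj₂ first))
    earlier = proj₂ (proj₂ first)
    j≤L : j ≤ suc L
    j≤L = ≮⇒≥ (λ L<j → earlier (suc L) L<j (zero , closed))
    distinct : ∀ a b → a < b → b < j → f a ≢ f b
    distinct a b a<b b<j fa≡fb = earlier b b<j (fromℕ< a<b , trans (cong f (toℕ-fromℕ< a<b)) fa≡fb)

  closed⇒cycle : ∀ f L → Adjacent f (suc L) → NonBacktracking f (suc L) → f 0 ≡ f (suc L) → Cycle G (full G)
  closed⇒cycle f L A N closed with first-repeat f L closed
  ... | i , j , i<j , j≤L , fi≡fj , distinct with ≤-split i<j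
  ...   | zero , refl = ⊥-elim (no-loop (f i) (subst (λ z → adj (f i) z ≡ true) (sym fi≡fi+1) (A i i<L)))
    where
    fi≡fi+1 : f i ≡ f (suc i)
    fi≡fi+1 = trans fi≡fj (cong f (cong suc (+-identityʳ i)))
    i<L : i < suc L
    i<L = subst (_≤ suc L) (cong suc (+-identityʳ i)) j≤L
  ...   | suc zero , refl = ⊥-elim (N i (subst (_≤ suc L) i+2 j≤L) (trans fi≡fj (cong f i+2)))
    where
    i+2 : suc (i + 1) ≡ 2 + i
    i+2 = cong suc (+-comm i 1)
  ...   | suc (suc m) , refl = m , c , injective , (λ _ → refl) , steps , closing
    where
    c : Fin (3 + m) → V G
    c k = f (i + toℕ k)
    j≡ : suc (i + suc (suc m)) ≡ i + (3 + m)
    j≡ = sym (+-suc i (2 + m))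
    in-range : ∀ t → t < 3 + m → i + t < suc (i + suc (suc m))
    in-range t lt = subst (i + t <_) (sym j≡) (+-monoʳ-< i lt)
    injective : ∀ {k k′} → c k ≡ c k′ → k ≡ k′
    injective {k} {k′} eq = by-order (<-cmp (toℕ k) (toℕ k′))
      where
      by-order : Tri (toℕ k < toℕ k′) (toℕ k ≡ toℕ k′) (toℕ k > toℕ k′) → k ≡ k′
      by-order (tri< lt _ _) = ⊥-elim (distinct _ _ (+-monoʳ-< i lt) (in-range _ (toℕ<n k′)) eq)
      by-order (tri≈ _ e _) = toℕ-injective e
      by-order (tri> _ _ gt) = ⊥-elim (distinct _ _ (+-monoʳ-< i gt) (in-range _ (toℕ<n k)) (sym eq))
    steps : ∀ (k : Fin (2 + m)) → adj (c (inject₁ k)) (c (suc k)) ≡ true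
    steps k = subst₂ (λ a b → adj (f a) (f b) ≡ true)
                (cong (i +_) (sym (toℕ-inject₁ k))) (sym (+-suc i (toℕ k)))
                (A (i + toℕ k) (subst (_≤ suc L) (+-suc i (toℕ k)) (≤-trans (<⇒≤ (in-range (suc (toℕ k)) (s≤s (toℕ<n k)))) j≤L)))
    closing : adj (c (fromℕ (2 + m))) (c zero) ≡ true
    closing = subst₂ (λ a b → adj (f a) b ≡ true)
                (cong (i +_) (sym (toℕ-fromℕ (2 + m))))
                (trans (sym fi≡fj) (cong f (sym (+-identityʳ i))))
                (A (i + (2 + m)) j≤L)

  Neighbour : VSet G → V G → V G → Set
  Neighbour S v u = S u ≡ true × adj v u ≡ true

  deg-count : ∀ S v → deg G S v ≡ count (λ u → S u ∧ adj v u)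
  deg-count S v = sum-map-tabulate n _ (λ u → u)

  deg-≤ : ∀ S v xs → (∀ u → Neighbour S v u → u ∈ xs) → deg G S v ≤ length xs
  deg-≤ S v xs covered = subst (_≤ length xs) (sym (deg-count S v))
    (count-≤-length _ xs (λ u e → covered u (∧-conicalˡ _ _ e , ∧-conicalʳ _ _ e)))

  deg-≥ : ∀ S v {xs} → Unique xs → All (Neighbour S v) xs → length xs ≤ deg G S v
  deg-≥ S v {xs} unique nbrs = subst (length xs ≤_) (sym (deg-count S v))
    (length-≤-count _ unique (All.map (λ (su , a) → cong₂ _∧_ su a) nbrs))

  neighbour-∉ : ∀ S v xs → length xs < deg G S v → ∃ λ u → Neighbour S v u × u ∉ xs
  neighbour-∉ S v xs lt with fresh-witness _ xs (subst (length xs <_) (deg-count S v) lt)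
  ... | u , e , u∉xs = u , (∧-conicalˡ _ _ e , ∧-conicalʳ _ _ e) , u∉xs

  neighbours : ∀ S v k → k ≤ deg G S v →
               Σ (List (V G)) λ xs → length xs ≡ k × Unique xs × All (Neighbour S v) xs
  neighbours S v zero _ = [] , refl , [] , []
  neighbours S v (suc k) le with neighbours S v k (≤-trans (n≤1+n k) le)
  ... | xs , refl , unique , nbrs with neighbour-∉ S v xs le
  ... | u , nbr , u∉xs = u ∷ xs , refl , ¬Any⇒All¬ xs u∉xs ∷ unique , nbr ∷ nbrs

  module _ (tree : IsTree G) where

    acyclic : ¬ Cycle G (full G)
    acyclic = proj₂ (proj₂ tree)

    connected : Connected G (full G)
    connected = proj₁ (proj₂ tree)

    -- If f and g differed, f followed by g reversed would close up into a non-backtracking cycle.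
    nb-unique : ∀ L f L′ g → Adjacent f L → NonBacktracking f L → Adjacent g L′ → NonBacktracking g L′ →
                f 0 ≡ g 0 → f L ≡ g L′ → L ≡ L′ × (∀ i → i ≤ L → f i ≡ g i)
    nb-unique zero f zero g Af Nf Ag Ng e0 eL = refl , λ { zero z≤n → e0 }
    nb-unique zero f (suc L′) g Af Nf Ag Ng e0 eL = ⊥-elim (acyclic (closed⇒cycle g L′ Ag Ng (trans (sym e0) eL)))
    nb-unique (suc L) f zero g Af Nf Ag Ng e0 eL = ⊥-elim (acyclic (closed⇒cycle f L Af Nf (trans e0 (sym eL))))
    nb-unique (suc L₁) f (suc L₂) g Af Nf Ag Ng e0 eL with f L₁ ≟ᵛ g L₂
    ... | yes e with nb-unique L₁ f L₂ g (Adjacent-≤ f (n≤1+n L₁) Af) (NonBacktracking-≤ f (n≤1+n L₁) Nf)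
                                         (Adjacent-≤ g (n≤1+n L₂) Ag) (NonBacktracking-≤ g (n≤1+n L₂) Ng) e0 e
    ...   | refl , agree = refl , agree′
      where
      agree′ : ∀ i → i ≤ suc L₁ → f i ≡ g i
      agree′ i le with m≤n⇒m<n∨m≡n le
      ... | inj₁ (s≤s lt) = agree i lt
      ... | inj₂ refl = eL
    nb-unique (suc L₁) f (suc L₂) g Af Nf Ag Ng e0 eL | no ne =
      ⊥-elim (acyclic (closed⇒cycle h (L₁ + suc L₂) Ah Nh closed))
      where
      h = append f (suc L₁) (reverse g (suc L₂))
      Ah = Adjacent-append f (suc L₁) (reverse g (suc L₂)) (suc L₂) Af (Adjacent-reverse g (suc L₂) Ag) eL
      Nh = NonBacktracking-append f (suc L₁) (reverse g (suc L₂)) (suc L₂) Nf (NonBacktracking-reverse g (suc L₂) Ng) eL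
             (λ a e _ → subst (λ z → f z ≢ g L₂) (suc-injective e) ne)
      closed : h 0 ≡ h (suc L₁ + suc L₂)
      closed = trans (append-≤ f (suc L₁) (reverse g (suc L₂)) 0 z≤n eL)
                 (trans e0 (sym (trans (append-+ f (suc L₁) (reverse g (suc L₂)) (suc L₂)) (reverse-end g (suc L₂)))))

    nb-geodesic : ∀ f L → Adjacent f L → NonBacktracking f L → ∀ k → Walk G (full G) (f 0) (f L) k → L ≤ k
    nb-geodesic f L Af Nf k W with shortest-walk W
    ... | d , Wd , min with walk→path Wd
    ... | g , g0 , gd , Ag , Ig = subst (_≤ k) (sym L≡d) (min k W)
      where
      Ng : NonBacktracking g d
      Ng = geodesic⇒NonBacktracking g d Ag Ig (λ j Wj → min j (subst₂ (λ a b → Walk G (full G) a b j) g0 gd Wj))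
      L≡d = proj₁ (nb-unique L f d g Af Nf Ag Ng (sym g0) (sym gd))

    abstract
      shortest : ∀ u w → ∃ λ d → Dist G (full G) u w d
      shortest u w = shortest-walk (proj₂ (connected u w refl refl))

    dist : V G → V G → ℕ
    dist u w = proj₁ (shortest u w)

    dist-walk : ∀ u w → Walk G (full G) u w (dist u w)
    dist-walk u w = proj₁ (proj₂ (shortest u w))

    dist-min : ∀ u w k → Walk G (full G) u w k → dist u w ≤ k
    dist-min u w = proj₂ (proj₂ (shortest u w))

    dist-sym : ∀ u w → dist u w ≡ dist w u
    dist-sym u w = ≤-antisym (dist-min u w _ (walk-reverse (dist-walk w u))) (dist-min w u _ (walk-reverse (dist-walk u w)))

    dist-triangle : ∀ u w x → dist u x ≤ dist u w + dist w x
    dist-triangle u w x = dist-min u x _ (walk-++ (dist-walk u w) (dist-walk w x))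

    dist-refl : ∀ u → dist u u ≡ 0
    dist-refl u = n≤0⇒n≡0 (dist-min u u 0 (here refl))

    dist≡0⇒≡ : ∀ {u w} → dist u w ≡ 0 → u ≡ w
    dist≡0⇒≡ {u} {w} e = walk₀ (subst (Walk G (full G) u w) e (dist-walk u w))
      where
      walk₀ : Walk G (full G) u w 0 → u ≡ w
      walk₀ (here _) = refl

    dist-adj : ∀ {u w} → adj u w ≡ true → dist u w ≤ 1
    dist-adj a = dist-min _ _ 1 (step refl a (here refl))

    dist-step : ∀ {u w} → u ≡ w ⊎ adj u w ≡ true → dist u w ≤ 1
    dist-step (inj₁ refl) = ≤-trans (≤-reflexive (dist-refl _)) z≤n
    dist-step (inj₂ a) = dist-adj a

    nb-dist : ∀ f L → Adjacent f L → NonBacktracking f L → dist (f 0) (f L) ≡ L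
    nb-dist f L A N = ≤-antisym (dist-min _ _ L (path→full-walk f L A)) (nb-geodesic f L A N _ (dist-walk _ _))

    nb-prefix-dist : ∀ f L → Adjacent f L → NonBacktracking f L → ∀ i → i ≤ L → dist (f 0) (f i) ≡ i
    nb-prefix-dist f L A N i le = nb-dist f i (Adjacent-≤ f le A) (NonBacktracking-≤ f le N)

    nb-segment-dist : ∀ f L → Adjacent f L → NonBacktracking f L → ∀ a t → a + t ≤ L → dist (f a) (f (a + t)) ≡ t
    nb-segment-dist f L A N a t le =
      trans (cong (λ z → dist (f z) (f (a + t))) (sym (+-identityʳ a)))
        (nb-dist (shift a f) t (Adjacent-shift f a (Adjacent-≤ f le A)) (NonBacktracking-shift f a (NonBacktracking-≤ f le N)))

    geodesic-path : ∀ u w → Σ Path λ g → g 0 ≡ u × g (dist u w) ≡ w × Adjacent g (dist u w) × NonBacktracking g (dist u w)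
    geodesic-path u w with walk→path (dist-walk u w)
    ... | g , g0 , gd , Ag , Ig = g , g0 , gd , Ag ,
          geodesic⇒NonBacktracking g (dist u w) Ag Ig (λ j Wj → dist-min u w j (subst₂ (λ a b → Walk G (full G) a b j) g0 gd Wj))

    geodesic : V G → V G → Path
    geodesic u w = proj₁ (geodesic-path u w)

    geodesic-start : ∀ u w → geodesic u w 0 ≡ u
    geodesic-start u w = proj₁ (proj₂ (geodesic-path u w))

    geodesic-end : ∀ u w → geodesic u w (dist u w) ≡ w
    geodesic-end u w = proj₁ (proj₂ (proj₂ (geodesic-path u w)))

    geodesic-adjacent : ∀ u w → Adjacent (geodesic u w) (dist u w)
    geodesic-adjacent u w = proj₁ (proj₂ (proj₂ (proj₂ (geodesic-path u w))))

    geodesic-nb : ∀ u w → NonBacktracking (geodesic u w) (dist u w)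
    geodesic-nb u w = proj₂ (proj₂ (proj₂ (proj₂ (geodesic-path u w))))

    geodesic-prefix-dist : ∀ u w i → i ≤ dist u w → dist u (geodesic u w i) ≡ i
    geodesic-prefix-dist u w i le = trans (cong (λ z → dist z (geodesic u w i)) (sym (geodesic-start u w)))
      (nb-prefix-dist (geodesic u w) (dist u w) (geodesic-adjacent u w) (geodesic-nb u w) i le)

    dist-suc : ∀ q x → x ≢ q → ∃ λ k → dist q x ≡ suc k
    dist-suc q x ne with dist q x in eq
    ... | zero = ⊥-elim (ne (sym (dist≡0⇒≡ eq)))
    ... | suc k = k , refl

    geodesic-first : ∀ q x k → dist q x ≡ suc k → adj q (geodesic q x 1) ≡ true
    geodesic-first q x k e = subst (λ z → adj z (geodesic q x 1) ≡ true) (geodesic-start q x)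
      (geodesic-adjacent q x 0 (subst (0 <_) (sym e) (s≤s z≤n)))

    geodesic-tail : ∀ q x k → dist q x ≡ suc k → dist (geodesic q x 1) x ≤ k
    geodesic-tail q x k e = dist-min _ _ k
      (subst (λ z → Walk G (full G) (geodesic q x 1) z k) (trans (cong (geodesic q x) (sym e)) (geodesic-end q x))
        (path→full-walk (shift 1 (geodesic q x)) k (Adjacent-shift (geodesic q x) 1 (subst (Adjacent (geodesic q x)) e (geodesic-adjacent q x)))))

    via : V G → V G → V G → Path
    via r u w = extend (geodesic r u) (dist r u) w

    via-start : ∀ r u w → via r u w 0 ≡ r
    via-start r u w = trans (extend-≤ (geodesic r u) (dist r u) w 0 z≤n) (geodesic-start r u)

    via-end : ∀ r u w → via r u w (suc (dist r u)) ≡ w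
    via-end r u w = extend-end (geodesic r u) (dist r u) w

    via-penultimate : ∀ r u w → via r u w (dist r u) ≡ u
    via-penultimate r u w = trans (extend-≤ (geodesic r u) (dist r u) w _ ≤-refl) (geodesic-end r u)

    via-adjacent : ∀ r u w → adj u w ≡ true → Adjacent (via r u w) (suc (dist r u))
    via-adjacent r u w a = Adjacent-extend (geodesic r u) (dist r u) w (geodesic-adjacent r u)
      (subst (λ z → adj z w ≡ true) (sym (geodesic-end r u)) a)

    via-nb : ∀ r u w → (∀ b → dist r u ≡ suc b → dist r w ≢ b) → NonBacktracking (via r u w) (suc (dist r u))
    via-nb r u w not-back = NonBacktracking-extend (geodesic r u) (dist r u) w (geodesic-nb r u) turn
      where
      turn : ∀ b → dist r u ≡ suc b → geodesic r u b ≢ w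
      turn b eb gb = not-back b eb
        (trans (cong (dist r) (sym gb)) (geodesic-prefix-dist r u b (subst (b ≤_) (sym eb) (n≤1+n b))))

    via-dist : ∀ r u w → adj u w ≡ true → (∀ b → dist r u ≡ suc b → dist r w ≢ b) → dist r w ≡ suc (dist r u)
    via-dist r u w a not-back = subst₂ (λ x y → dist x y ≡ suc (dist r u)) (via-start r u w) (via-end r u w)
      (nb-dist (via r u w) _ (via-adjacent r u w a) (via-nb r u w not-back))

    adjacent-levels : ∀ r {u w} → adj u w ≡ true → dist r w ≡ suc (dist r u) ⊎ dist r u ≡ suc (dist r w)
    adjacent-levels r {u} {w} a with <-cmp (dist r u) (dist r w)
    ... | tri< lt _ _ = inj₁ (≤-antisym (one-more u w a) lt)
      where
      one-more : ∀ u w → adj u w ≡ true → dist r w ≤ suc (dist r u)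
      one-more u w a = ≤-trans (dist-triangle r u w) (subst (dist r u + dist u w ≤_) (+-comm (dist r u) 1) (+-monoʳ-≤ (dist r u) (dist-adj a)))
    ... | tri> _ _ gt = inj₂ (≤-antisym (≤-trans (dist-triangle r w u) (subst (dist r w + dist w u ≤_) (+-comm (dist r w) 1)
                                                   (+-monoʳ-≤ (dist r w) (dist-adj (trans (adj-sym w u) a))))) gt)
    ... | tri≈ _ same _ = ⊥-elim (1+n≢n (trans (cong suc (sym same)) (sym (via-dist r u w a not-back))))
      where
      not-back : ∀ b → dist r u ≡ suc b → dist r w ≢ b
      not-back b eb ew = 1+n≢n (trans (sym eb) (trans same ew))

    parent-unique : ∀ r {x y y′} → adj x y ≡ true → adj x y′ ≡ true →
                    dist r x ≡ suc (dist r y) → dist r x ≡ suc (dist r y′) → y ≡ y′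
    parent-unique r {x} {y} {y′} a a′ e e′ =
      trans (sym (via-penultimate r y x)) (trans (agree (dist r y) (n≤1+n _))
        (trans (cong (via r y′ x) (suc-injective (trans (sym e) e′))) (via-penultimate r y′ x)))
      where
      not-back : ∀ {y} → dist r x ≡ suc (dist r y) → ∀ b → dist r y ≡ suc b → dist r x ≢ b
      not-back e b eb ex = m≢1+n+m b {1} (trans (sym ex) (trans e (cong suc eb)))
      agree = proj₂ (nb-unique (suc (dist r y)) (via r y x) (suc (dist r y′)) (via r y′ x)
                (via-adjacent r y x (trans (adj-sym y x) a)) (via-nb r y x (not-back e))
                (via-adjacent r y′ x (trans (adj-sym y′ x) a′)) (via-nb r y′ x (not-back e′))
                (trans (via-start r y x) (sym (via-start r y′ x)))
                (trans (via-end r y x) (sym (via-end r y′ x))))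

    -- With root r, x lies in the subtree of q exactly when q is on the geodesic from r to x.
    InSubtree : V G → V G → V G → Set
    InSubtree r q x = dist r x ≡ dist r q + dist q x

    InSubtree? : ∀ r q x → Dec (InSubtree r q x)
    InSubtree? r q x = dist r x ≟ dist r q + dist q x

    InSubtree-root : ∀ r x → InSubtree r r x
    InSubtree-root r x = cong (_+ dist r x) (sym (dist-refl r))

    InSubtree-child : ∀ r {q c x} → adj q c ≡ true → dist r c ≡ suc (dist r q) → InSubtree r c x →
                      InSubtree r q x × dist q x ≡ suc (dist c x)
    InSubtree-child r {q} {c} {x} a e in-c = trans rx (cong (dist r q +_) (sym qx)) , qx
      where
      rx : dist r x ≡ dist r q + suc (dist c x)
      rx = trans in-c (trans (cong (_+ dist c x) e) (sym (+-suc (dist r q) (dist c x))))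
      qx : dist q x ≡ suc (dist c x)
      qx = ≤-antisym (≤-trans (dist-triangle q c x) (+-monoˡ-≤ (dist c x) (dist-adj a)))
                     (+-cancelˡ-≤ (dist r q) _ _ (subst (_≤ dist r q + dist q x) rx (dist-triangle r q x)))

    InSubtree-descend : ∀ r {q x} → InSubtree r q x → x ≢ q →
                        Σ (V G) λ c → adj q c ≡ true × dist r c ≡ suc (dist r q) × InSubtree r c x
    InSubtree-descend r {q} {x} in-q x≢q with dist-suc q x x≢q
    ... | k , qx = c , a , rc , in-c
      where
      c = geodesic q x 1
      a = geodesic-first q x k qx
      cx : dist c x ≤ k
      cx = geodesic-tail q x k qx
      rx : dist r x ≡ suc (dist r q + k)
      rx = trans in-q (trans (cong (dist r q +_) qx) (+-suc _ k))
      rc : dist r c ≡ suc (dist r q)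
      rc with adjacent-levels r a
      ... | inj₁ e = e
      ... | inj₂ e = ⊥-elim (<⇒≱ shorter (≤-reflexive (sym rx)))
        where
        shorter : dist r x < suc (dist r q + k)
        shorter = s≤s (≤-trans (dist-triangle r c x) (≤-trans (+-monoʳ-≤ (dist r c) cx)
                    (+-monoˡ-≤ k (≤-trans (n≤1+n _) (≤-reflexive (sym e))))))
      in-c : InSubtree r c x
      in-c = ≤-antisym (dist-triangle r c x)
               (≤-trans (+-monoʳ-≤ (dist r c) cx) (≤-reflexive (sym (trans rx (sym (cong (_+ k) rc))))))

    InSubtree-exit : ∀ r {q x y} → InSubtree r q x → adj x y ≡ true → ¬ InSubtree r q y →
                     x ≡ q × dist r q ≡ suc (dist r y)
    InSubtree-exit r {q} {x} {y} in-q a out with adjacent-levels r a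
    ... | inj₁ e = ⊥-elim (out (≤-antisym (dist-triangle r q y) ge))
      where
      qy : dist q y ≤ suc (dist q x)
      qy = ≤-trans (dist-triangle q x y) (≤-trans (+-monoʳ-≤ (dist q x) (dist-adj a)) (≤-reflexive (+-comm _ 1)))
      ge : dist r q + dist q y ≤ dist r y
      ge = ≤-trans (+-monoʳ-≤ (dist r q) qy) (≤-reflexive (trans (+-suc _ _) (trans (cong suc (sym in-q)) (sym e))))
    ... | inj₂ e with x ≟ᵛ q
    ...   | yes refl = refl , e
    ...   | no x≢q = ⊥-elim (out in-y)
      where
      kk = dist-suc x q (x≢q ∘ sym)
      k = proj₁ kk
      xq : dist x q ≡ suc k
      xq = proj₂ kk
      z = geodesic x q 1
      zq : dist q z ≤ k
      zq = ≤-trans (≤-reflexive (dist-sym q z)) (geodesic-tail x q k xq)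
      ry : dist r y ≡ dist r q + k
      ry = suc-injective (trans (sym e) (trans in-q (trans (cong (dist r q +_) (trans (dist-sym q x) xq)) (+-suc _ k))))
      rz : dist r z ≤ dist r y
      rz = ≤-trans (dist-triangle r q z) (≤-trans (+-monoʳ-≤ (dist r q) zq) (≤-reflexive (sym ry)))
      z≡y : z ≡ y
      z≡y with adjacent-levels r (geodesic-first x q k xq)
      ... | inj₁ e₂ = ⊥-elim (<⇒≱ (≤-trans (n≤1+n _) (≤-reflexive (trans (cong suc (sym e)) (sym e₂)))) rz)
      ... | inj₂ e₂ = parent-unique r (geodesic-first x q k xq) a e₂ e
      in-y : InSubtree r q y
      in-y = ≤-antisym (dist-triangle r q y)
               (≤-trans (+-monoʳ-≤ (dist r q) (subst (λ w → dist q w ≤ k) z≡y zq)) (≤-reflexive (sym ry)))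

    data Ray : V G → V G → ℕ → Set where
      stop : ∀ {p c} → Ray p c 0
      go : ∀ {p c w K} → adj c w ≡ true → w ≢ p → Ray c w K → Ray p c (suc K)

    ray? : ∀ K p c → Dec (Ray p c K)
    ray? zero p c = yes stop
    ray? (suc K) p c with any? (λ w → (adj c w ≟ᵇ true) ×-dec (¬? (w ≟ᵛ p) ×-dec ray? K c w))
    ... | yes (w , a , w≢p , R) = yes (go a w≢p R)
    ... | no none = no λ { (go {w = w} a w≢p R) → none (w , a , w≢p , R) }

    Ray-≤ : ∀ {p c j k} → j ≤ k → Ray p c k → Ray p c j
    Ray-≤ z≤n _ = stop
    Ray-≤ (s≤s le) (go a w≢p R) = go a w≢p (Ray-≤ le R)

    ray→path : ∀ {p c K} → adj p c ≡ true → Ray p c K →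
               Σ Path λ f → f 0 ≡ c × Adjacent (cons p f) (suc K) × NonBacktracking (cons p f) (suc K)
    ray→path {p} {c} a stop = (λ _ → c) , refl , (λ { zero _ → a ; (suc i) (s≤s ()) }) , λ { i (s≤s ()) }
    ray→path {p} {c} a (go a′ w≢p R) with ray→path a′ R
    ... | g , g0 , gA , gN = cons c g , refl , A , N
      where
      A : Adjacent (cons p (cons c g)) _
      A zero _ = a
      A (suc i) (s≤s lt) = gA i lt
      N : NonBacktracking (cons p (cons c g)) _
      N zero _ e = w≢p (trans (sym g0) (sym e))
      N (suc i) (s≤s le) = gN i le

    path→ray : ∀ f K → Adjacent f (suc K) → NonBacktracking f (suc K) → Ray (f 0) (f 1) K
    path→ray f zero A N = stop
    path→ray f (suc K) A N = go (A 1 (s≤s (s≤s z≤n))) (λ e → N 0 (s≤s (s≤s z≤n)) (sym e))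
      (path→ray (shift 1 f) K (λ i lt → A (suc i) (s≤s lt)) (λ i le → N (suc i) (s≤s le)))

    nb-injective : ∀ f L → Adjacent f L → NonBacktracking f L → ∀ i j → i ≤ L → j ≤ L → f i ≡ f j → i ≡ j
    nb-injective f L A N i j i≤L j≤L e =
      trans (sym (nb-prefix-dist f L A N i i≤L)) (trans (cong (dist (f 0)) e) (nb-prefix-dist f L A N j j≤L))

    nb-length-< : ∀ f L → Adjacent f L → NonBacktracking f L → L < n
    nb-length-< f L A N = injective⇒≤ {f = f ∘ toℕ} λ e →
      toℕ-injective (nb-injective f L A N _ _ (≤-pred (toℕ<n _)) (≤-pred (toℕ<n _)) e)

    -- v is the origin of a (not necessarily induced) triod whose legs have length k + 1, not k.
    record ThreeLegs (v : V G) (k : ℕ) : Set where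
      field
        foot : Fin 3 → V G
        foot-adj : ∀ j → adj v (foot j) ≡ true
        foot-injective : ∀ {i j} → foot i ≡ foot j → i ≡ j
        ray : ∀ j → Ray v (foot j) k

    feet : ∀ {v k} → ThreeLegs v k → List (V G)
    feet legs = foot zero ∷ foot (suc zero) ∷ foot (suc (suc zero)) ∷ []
      where open ThreeLegs legs

    feet-unique : ∀ {v k} (legs : ThreeLegs v k) → Unique (feet legs)
    feet-unique legs = (distinct (λ ()) ∷ distinct (λ ()) ∷ []) ∷ (distinct (λ ()) ∷ []) ∷ [] ∷ []
      where
      open ThreeLegs legs
      distinct : ∀ {i j} → i ≢ j → foot i ≢ foot j
      distinct i≢j e = i≢j (foot-injective e)

    triple : ∀ {A : Set} → A → A → A → Fin 3 → A
    triple a b c zero = a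
    triple a b c (suc zero) = b
    triple a b c (suc (suc zero)) = c

    triple-∀ : ∀ {A : Set} {P : A → Set} {a b c} → P a → P b → P c → ∀ j → P (triple a b c j)
    triple-∀ pa pb pc zero = pa
    triple-∀ pa pb pc (suc zero) = pb
    triple-∀ pa pb pc (suc (suc zero)) = pc

    triple-injective : ∀ {A B : Set} (h : A → B) {a b c} → h a ≢ h b → h a ≢ h c → h b ≢ h c →
                       ∀ {i j} → h (triple a b c i) ≡ h (triple a b c j) → i ≡ j
    triple-injective h ab ac bc {zero} {zero} _ = refl
    triple-injective h ab ac bc {zero} {suc zero} e = ⊥-elim (ab e)
    triple-injective h ab ac bc {zero} {suc (suc zero)} e = ⊥-elim (ac e)
    triple-injective h ab ac bc {suc zero} {zero} e = ⊥-elim (ab (sym e))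
    triple-injective h ab ac bc {suc zero} {suc zero} _ = refl
    triple-injective h ab ac bc {suc zero} {suc (suc zero)} e = ⊥-elim (bc e)
    triple-injective h ab ac bc {suc (suc zero)} {zero} e = ⊥-elim (ac (sym e))
    triple-injective h ab ac bc {suc (suc zero)} {suc zero} e = ⊥-elim (bc (sym e))
    triple-injective h ab ac bc {suc (suc zero)} {suc (suc zero)} _ = refl

    Foot : V G → ℕ → V G → Set
    Foot v k y = adj v y ≡ true × Ray v y k

    legs-from-feet : ∀ {v k a b c} → a ≢ b → a ≢ c → b ≢ c → Foot v k a → Foot v k b → Foot v k c → ThreeLegs v k
    legs-from-feet {v} {k} ab ac bc fa fb fc = record
      { foot = triple _ _ _
      ; foot-adj = triple-∀ {P = λ y → adj v y ≡ true} (proj₁ fa) (proj₁ fb) (proj₁ fc)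
      ; foot-injective = triple-injective (λ y → y) ab ac bc
      ; ray = triple-∀ {P = λ y → Ray v y k} (proj₂ fa) (proj₂ fb) (proj₂ fc)
      }

    path-foot : ∀ {v k} f L → f 0 ≡ v → Adjacent f L → NonBacktracking f L → suc k ≤ L → Foot v k (f 1)
    path-foot {k = k} f L refl A N le =
      A 0 (≤-trans (s≤s z≤n) le) , path→ray f k (Adjacent-≤ f le A) (NonBacktracking-≤ f le N)

    ThreeLegs? : ∀ v k → Dec (ThreeLegs v k)
    ThreeLegs? v k with any? (λ a → any? λ b → any? λ c →
                          (¬? (a ≟ᵛ b) ×-dec (¬? (a ≟ᵛ c) ×-dec ¬? (b ≟ᵛ c))) ×-dec
                          (Foot? a ×-dec (Foot? b ×-dec Foot? c)))
      where
      Foot? : ∀ y → Dec (Foot v k y)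
      Foot? y = (adj v y ≟ᵇ true) ×-dec ray? k v y
    ... | yes (a , b , c , (ab , ac , bc) , fa , fb , fc) = yes (legs-from-feet ab ac bc fa fb fc)
    ... | no none = no λ legs → let open ThreeLegs legs in
      none (foot zero , foot (suc zero) , foot (suc (suc zero)) ,
            distinct-feet legs ,
            (foot-adj zero , ray zero) , (foot-adj (suc zero) , ray (suc zero)) , (foot-adj (suc (suc zero)) , ray (suc (suc zero))))
      where
      distinct-feet : (legs : ThreeLegs v k) → let open ThreeLegs legs in
                      foot zero ≢ foot (suc zero) × foot zero ≢ foot (suc (suc zero)) × foot (suc zero) ≢ foot (suc (suc zero))
      distinct-feet legs with feet-unique legs
      ... | (a≢b ∷ a≢c ∷ []) ∷ (b≢c ∷ []) ∷ [] ∷ [] = a≢b , a≢c , b≢c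

    ThreeLegs-≤ : ∀ {v k j} → j ≤ k → ThreeLegs v k → ThreeLegs v j
    ThreeLegs-≤ le legs = record
      { foot = foot ; foot-adj = foot-adj ; foot-injective = foot-injective ; ray = λ j → Ray-≤ le (ray j) }
      where open ThreeLegs legs

    ThreeLegs-< : ∀ {v k} → ThreeLegs v k → k < n
    ThreeLegs-< {v} {k} legs with ray→path (foot-adj zero) (ray zero)
      where open ThreeLegs legs
    ... | f , _ , A , N = <-trans (n<1+n k) (nb-length-< (cons v f) (suc k) A N)

    legs-from-degree : ∀ {v} → 3 ≤ deg G (full G) v → ThreeLegs v 0
    legs-from-degree {v} le with neighbours (full G) v 3 le
    ... | a ∷ b ∷ c ∷ [] , refl , (ab ∷ ac ∷ []) ∷ (bc ∷ []) ∷ [] ∷ [] , (_ , va) ∷ (_ , vb) ∷ (_ , vc) ∷ [] =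
      legs-from-feet ab ac bc (va , stop) (vb , stop) (vc , stop)

    ThreeLegs⇒degree : ∀ {v k} → ThreeLegs v k → 3 ≤ deg G (full G) v
    ThreeLegs⇒degree {v} legs = deg-≥ (full G) v (feet-unique legs) (at-foot zero ∷ at-foot (suc zero) ∷ at-foot (suc (suc zero)) ∷ [])
      where
      open ThreeLegs legs
      at-foot : ∀ j → Neighbour (full G) v (foot j)
      at-foot j = refl , foot-adj j

    module TriodOfLegs {v : V G} {k : ℕ} (legs : ThreeLegs v k) where

      open ThreeLegs legs

      K : ℕ
      K = suc k

      leg : Fin 3 → Path
      leg j = cons v (proj₁ (ray→path (foot-adj j) (ray j)))

      leg-foot : ∀ j → leg j 1 ≡ foot j
      leg-foot j = proj₁ (proj₂ (ray→path (foot-adj j) (ray j)))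

      leg-adjacent : ∀ j → Adjacent (leg j) K
      leg-adjacent j = proj₁ (proj₂ (proj₂ (ray→path (foot-adj j) (ray j))))

      leg-nb : ∀ j → NonBacktracking (leg j) K
      leg-nb j = proj₂ (proj₂ (proj₂ (ray→path (foot-adj j) (ray j))))

      leg-dist : ∀ j a t → a + t ≤ K → dist (leg j a) (leg j (a + t)) ≡ t
      leg-dist j = nb-segment-dist (leg j) K (leg-adjacent j) (leg-nb j)

      legs-dist : ∀ {i j} → i ≢ j → ∀ a b → a ≤ K → b ≤ K → dist (leg i a) (leg j b) ≡ a + b
      legs-dist {i} {j} i≢j a b a≤K b≤K = subst₂ (λ x y → dist x y ≡ a + b) start end (nb-dist h (a + b) hA hN)
        where
        back = reverse (leg i) a
        h = append back a (leg j)
        join : back a ≡ leg j 0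
        join = reverse-end (leg i) a
        hA = Adjacent-append back a (leg j) b (Adjacent-reverse (leg i) a (Adjacent-≤ (leg i) a≤K (leg-adjacent i)))
               (Adjacent-≤ (leg j) b≤K (leg-adjacent j)) join
        hN = NonBacktracking-append back a (leg j) b
               (NonBacktracking-reverse (leg i) a (NonBacktracking-≤ (leg i) a≤K (leg-nb i)))
               (NonBacktracking-≤ (leg j) b≤K (leg-nb j)) join
               (λ { a′ refl _ e → i≢j (foot-injective (trans (sym (leg-foot i))
                    (trans (cong (leg i) (sym (m+n∸n≡m 1 a′))) (trans e (leg-foot j))))) })
        start : h 0 ≡ leg i a
        start = append-≤ back a (leg j) 0 z≤n join
        end : h (a + b) ≡ leg j b
        end = append-+ back a (leg j) b

      OnLegs : V G → Set
      OnLegs x = Σ (Fin 3) λ j → Σ (Fin (suc K)) λ a → x ≡ leg j (toℕ a)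

      OnLegs? : ∀ x → Dec (OnLegs x)
      OnLegs? x = any? λ j → any? λ a → x ≟ᵛ leg j (toℕ a)

      S : VSet G
      S x = ⌊ OnLegs? x ⌋

      S-sound : ∀ x → ⌊ OnLegs? x ⌋ ≡ true → Σ (Fin 3) λ j → Σ ℕ λ a → a ≤ K × x ≡ leg j a
      S-sound x e with OnLegs? x
      ... | yes (j , a , x≡) = j , toℕ a , ≤-pred (toℕ<n a) , x≡

      S-complete : ∀ j a → a ≤ K → S (leg j a) ≡ true
      S-complete j a a≤K with OnLegs? (leg j a)
      ... | yes _ = refl
      ... | no none = ⊥-elim (none (j , fromℕ< (s≤s a≤K) , cong (leg j) (sym (toℕ-fromℕ< (s≤s a≤K)))))

      S-origin : S v ≡ true
      S-origin = S-complete zero 0 z≤n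

      close-on-leg : ∀ j a t → suc (a + t) ≤ K → dist (leg j a) (leg j (suc (a + t))) ≤ 1 → t ≡ 0
      close-on-leg j a t le d≤1
        with subst (_≤ 1) (subst (λ z → dist (leg j a) (leg j z) ≡ suc t) (+-suc a t) (leg-dist j a (suc t) (subst (_≤ K) (sym (+-suc a t)) le))) d≤1
      ... | s≤s z≤n = refl

      LegNeighbour : Fin 3 → ℕ → V G → Set
      LegNeighbour j a x = (suc a ≤ K × x ≡ leg j (suc a))
                         ⊎ (Σ ℕ λ a′ → a ≡ suc a′ × x ≡ leg j a′)
                         ⊎ (a ≡ 0 × Σ (Fin 3) λ i → x ≡ leg i 1)

      leg-neighbour : ∀ j a x → a ≤ K → Neighbour S (leg j a) x → LegNeighbour j a x
      leg-neighbour j a x a≤K (sx , ax) with S-sound x sx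
      ... | i , b , b≤K , refl with i ≟ᵛ j
      ...   | yes refl = along (<-cmp a b)
        where
        along : Tri (a < b) (a ≡ b) (a > b) → LegNeighbour i a (leg i b)
        along (tri< lt _ _) with ≤-split lt
        ... | t , refl with close-on-leg i a t b≤K (dist-adj ax)
        ...   | refl = inj₁ (≤-trans (s≤s (m≤m+n a 0)) b≤K , cong (leg i) (cong suc (+-identityʳ a)))
        along (tri≈ _ refl _) = ⊥-elim (no-loop _ ax)
        along (tri> _ _ gt) with ≤-split gt
        ... | t , refl with close-on-leg i b t a≤K (≤-trans (≤-reflexive (dist-sym _ _)) (dist-adj ax))
        ...   | refl = inj₂ (inj₁ (b , cong suc (+-identityʳ b) , refl))
      ...   | no i≢j = across a b (subst (_≤ 1) (legs-dist (i≢j ∘ sym) a b a≤K b≤K) (dist-adj ax)) ax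
        where
        across : ∀ a′ b′ → a′ + b′ ≤ 1 → adj (leg j a′) (leg i b′) ≡ true → LegNeighbour j a′ (leg i b′)
        across zero zero _ ax′ = ⊥-elim (no-loop _ ax′)
        across zero (suc zero) _ _ = inj₂ (inj₂ (refl , i , refl))
        across (suc zero) zero _ _ = inj₂ (inj₁ (0 , refl , refl))
        across zero (suc (suc _)) (s≤s ()) _
        across (suc zero) (suc _) (s≤s ()) _
        across (suc (suc _)) _ (s≤s ()) _

      leg-back : ∀ j a → a < K → Neighbour S (leg j (suc a)) (leg j a)
      leg-back j a lt = S-complete j a (≤-trans (n≤1+n a) lt) , trans (adj-sym _ _) (leg-adjacent j a lt)

      leg-forward : ∀ j a → a < K → Neighbour S (leg j a) (leg j (suc a))
      leg-forward j a lt = S-complete j (suc a) lt , leg-adjacent j a lt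

      deg-origin : deg G S v ≡ 3
      deg-origin = ≤-antisym (deg-≤ S v (feet legs) covered)
                             (deg-≥ S v (feet-unique legs) (at-foot zero ∷ at-foot (suc zero) ∷ at-foot (suc (suc zero)) ∷ []))
        where
        at-foot : ∀ j → Neighbour S v (foot j)
        at-foot j = subst (Neighbour S v) (leg-foot j) (leg-forward j 0 (s≤s z≤n))
        is-foot : ∀ {x} i → x ≡ foot i → x ∈ feet legs
        is-foot zero e = here e
        is-foot (suc zero) e = there (here e)
        is-foot (suc (suc zero)) e = there (there (here e))
        covered : ∀ x → Neighbour S v x → x ∈ feet legs
        covered x nbr with leg-neighbour zero 0 x z≤n nbr
        ... | inj₁ (_ , e) = is-foot zero (trans e (leg-foot zero))
        ... | inj₂ (inj₁ (_ , () , _))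
        ... | inj₂ (inj₂ (_ , i , e)) = is-foot i (trans e (leg-foot i))

      deg-inner : ∀ j a → suc a ≤ K → deg G S (leg j (suc a)) ≤ 2
      deg-inner j a le = deg-≤ S _ (leg j (suc (suc a)) ∷ leg j a ∷ []) covered
        where
        covered : ∀ x → Neighbour S (leg j (suc a)) x → x ∈ leg j (suc (suc a)) ∷ leg j a ∷ []
        covered x nbr with leg-neighbour j (suc a) x le nbr
        ... | inj₁ (_ , e) = here e
        ... | inj₂ (inj₁ (_ , refl , e)) = there (here e)
        ... | inj₂ (inj₂ (() , _))

      deg-middle : ∀ j a → suc a < K → 2 ≤ deg G S (leg j (suc a))
      deg-middle j a lt = deg-≥ S _ ((leg-nb j a lt ∷ []) ∷ [] ∷ []) (leg-back j a (<⇒≤ lt) ∷ leg-forward j (suc a) lt ∷ [])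

      deg-end : ∀ j → deg G S (leg j K) ≡ 1
      deg-end j = ≤-antisym (deg-≤ S _ (leg j k ∷ []) covered) (deg-≥ S _ ([] ∷ []) (leg-back j k ≤-refl ∷ []))
        where
        covered : ∀ x → Neighbour S (leg j K) x → x ∈ leg j k ∷ []
        covered x nbr with leg-neighbour j K x ≤-refl nbr
        ... | inj₁ (K<K , _) = ⊥-elim (<-irrefl refl K<K)
        ... | inj₂ (inj₁ (_ , refl , e)) = here e
        ... | inj₂ (inj₂ (() , _))

      leg-walk : ∀ j a → a ≤ K → Walk G S v (leg j a) a
      leg-walk j a a≤K = path→walk {S} (leg j) a (Adjacent-≤ (leg j) a≤K (leg-adjacent j)) (λ t t≤a → S-complete j t (≤-trans t≤a a≤K))

      S-tree : IsTreeOn G S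
      S-tree = (v , S-origin) , connected-S , acyclic-S
        where
        connected-S : Connected G S
        connected-S u w su sw with S-sound u su | S-sound w sw
        ... | i , a , a≤K , refl | j , b , b≤K , refl = a + b , walk-++ (walk-reverse (leg-walk i a a≤K)) (leg-walk j b b≤K)
        acyclic-S : ¬ Cycle G S
        acyclic-S (m , c , inj , _ , steps , closing) = acyclic (m , c , inj , (λ _ → refl) , steps , closing)

      only-origin : ∀ u → S u ≡ true → deg G S u ≡ 3 → u ≡ v
      only-origin u su d3 with S-sound u su
      ... | j , zero , _ , refl = refl
      ... | j , suc a , le , refl = ⊥-elim (<⇒≱ (s≤s (s≤s (s≤s z≤n))) (subst (_≤ 2) d3 (deg-inner j a le)))

      leaf : ∀ j → Leaf G S (leg j K)
      leaf j = S-complete j K ≤-refl , deg-end j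

      leaves-distinct : ∀ {i j} → i ≢ j → leg i K ≢ leg j K
      leaves-distinct {i} i≢j e with trans (sym (legs-dist i≢j K K ≤-refl ≤-refl)) (trans (cong (dist (leg i K)) (sym e)) (dist-refl _))
      ... | ()

      only-leaves : ∀ u → Leaf G S u → u ≡ leg zero K ⊎ u ≡ leg (suc zero) K ⊎ u ≡ leg (suc (suc zero)) K
      only-leaves u (su , d1) with S-sound u su
      ... | j , zero , _ , refl with () ← trans (sym deg-origin) d1
      ... | j , suc a , le , refl with m≤n⇒m<n∨m≡n le
      ...   | inj₁ lt = ⊥-elim (<⇒≱ (deg-middle j a lt) (≤-reflexive d1))
      ...   | inj₂ refl = which j
        where
        which : ∀ j → leg j K ≡ leg zero K ⊎ leg j K ≡ leg (suc zero) K ⊎ leg j K ≡ leg (suc (suc zero)) K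
        which zero = inj₁ refl
        which (suc zero) = inj₂ (inj₁ refl)
        which (suc (suc zero)) = inj₂ (inj₂ refl)

      leg-Dist : ∀ j → Dist G S v (leg j K) K
      leg-Dist j = leg-walk j K ≤-refl ,
        λ k′ W → subst (_≤ k′) (nb-dist (leg j) K (leg-adjacent j) (leg-nb j)) (dist-min v (leg j K) k′ (walk-full W))

      triod : TriodL3 G S v K
      triod = leg zero K , leg (suc zero) K , leg (suc (suc zero)) K ,
              (S-origin , S-tree , deg-origin , only-origin , leaf zero , leaf (suc zero) , leaf (suc (suc zero)) ,
               leaves-distinct (λ ()) , leaves-distinct (λ ()) , leaves-distinct (λ ()) , only-leaves) ,
              K , K , K , leg-Dist zero , leg-Dist (suc zero) , leg-Dist (suc (suc zero)) ,
              sym (trans (cong (_⊓ K) (⊓-idem K)) (⊓-idem K))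

    module LegsOfTriod {S : VSet G} {v a b c : V G} (T : IsTriod G S v a b c) where

      private
        deg-v = proj₁ (proj₂ (proj₂ T))
        only-origin = proj₁ (proj₂ (proj₂ (proj₂ T)))
        leaf-a = proj₁ (proj₂ (proj₂ (proj₂ (proj₂ T))))
        leaf-b = proj₁ (proj₂ (proj₂ (proj₂ (proj₂ (proj₂ T)))))
        leaf-c = proj₁ (proj₂ (proj₂ (proj₂ (proj₂ (proj₂ (proj₂ T))))))
        a≢b = proj₁ (proj₂ (proj₂ (proj₂ (proj₂ (proj₂ (proj₂ (proj₂ T)))))))
        a≢c = proj₁ (proj₂ (proj₂ (proj₂ (proj₂ (proj₂ (proj₂ (proj₂ (proj₂ T))))))))
        b≢c = proj₁ (proj₂ (proj₂ (proj₂ (proj₂ (proj₂ (proj₂ (proj₂ (proj₂ (proj₂ T)))))))))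
        only-leaves = proj₂ (proj₂ (proj₂ (proj₂ (proj₂ (proj₂ (proj₂ (proj₂ (proj₂ (proj₂ T)))))))))

      record SGeodesic (x : V G) (d : ℕ) : Set where
        field
          f : Path
          f0 : f 0 ≡ v
          fd : f d ≡ x
          fA : Adjacent f d
          fN : NonBacktracking f d
          fI : Inside S f d

      S-geodesic : ∀ {x d} → Dist G S v x d → SGeodesic x d
      S-geodesic {x} {d} (W , min) with walk→path W
      ... | f , f0 , fd , A , I = record
        { f = f ; f0 = f0 ; fd = fd ; fA = A ; fI = I
        ; fN = geodesic⇒NonBacktracking f d A I (λ j Wj → min j (subst₂ (λ p q → Walk G S p q j) f0 fd Wj))
        }

      record PathToLeaf (z w : V G) : Set where
        field
          g : Path
          L : ℕ
          1≤L : 1 ≤ L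
          g0 : g 0 ≡ z
          g1 : g 1 ≡ w
          gA : Adjacent g L
          gN : NonBacktracking g L
          gI : Inside S g L
          leaf : Leaf G S (g L)

      -- The fuel suffices because non-backtracking paths in a tree are shorter than n.
      path-to-leaf : ∀ fuel f L → Adjacent f L → NonBacktracking f L → Inside S f L → 1 ≤ L → n ≤ L + fuel →
                     PathToLeaf (f 0) (f 1)
      path-to-leaf fuel f (suc L) A N I 1≤L bound with deg G S (f (suc L)) ≤? 1
      ... | yes ≤1 = record { g = f ; L = suc L ; 1≤L = 1≤L ; g0 = refl ; g1 = refl ; gA = A ; gN = N ; gI = I
                            ; leaf = I _ ≤-refl , ≤-antisym ≤1 (deg-≥ S _ ([] ∷ []) (back ∷ [])) }
        where
        back : Neighbour S (f (suc L)) (f L)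
        back = I L (n≤1+n L) , trans (adj-sym _ _) (A L ≤-refl)
      ... | no ≰1 with fuel
      ...   | zero = ⊥-elim (<⇒≱ (nb-length-< f (suc L) A N) (subst (n ≤_) (+-identityʳ _) bound))
      ...   | suc fuel′ with neighbour-∉ S (f (suc L)) (f L ∷ []) (≰⇒> ≰1)
      ...     | x , (sx , ax) , x∉ =
        subst₂ PathToLeaf (extend-≤ f (suc L) x 0 z≤n) (extend-≤ f (suc L) x 1 (s≤s z≤n))
          (path-to-leaf fuel′ (extend f (suc L) x) (suc (suc L))
            (Adjacent-extend f (suc L) x A ax)
            (NonBacktracking-extend f (suc L) x N (λ { b refl e → x∉ (here (sym e)) }))
            (Inside-extend {S} f (suc L) x I sx) (s≤s z≤n)
            (subst (n ≤_) (+-suc (suc L) fuel′) bound))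

      LeafIndex : V G → Set
      LeafIndex x = x ≡ a ⊎ x ≡ b ⊎ x ≡ c

      index : ∀ {x} → LeafIndex x → Fin 3
      index (inj₁ _) = zero
      index (inj₂ (inj₁ _)) = suc zero
      index (inj₂ (inj₂ _)) = suc (suc zero)

      index-injective : ∀ {x y} (p : LeafIndex x) (q : LeafIndex y) → index p ≡ index q → x ≡ y
      index-injective (inj₁ refl) (inj₁ refl) _ = refl
      index-injective (inj₂ (inj₁ refl)) (inj₂ (inj₁ refl)) _ = refl
      index-injective (inj₂ (inj₂ refl)) (inj₂ (inj₂ refl)) _ = refl
      index-injective (inj₁ _) (inj₂ (inj₁ _)) ()
      index-injective (inj₁ _) (inj₂ (inj₂ _)) ()
      index-injective (inj₂ (inj₁ _)) (inj₁ _) ()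
      index-injective (inj₂ (inj₁ _)) (inj₂ (inj₂ _)) ()
      index-injective (inj₂ (inj₂ _)) (inj₁ _) ()
      index-injective (inj₂ (inj₂ _)) (inj₂ (inj₁ _)) ()

      -- Four neighbours of z would lead to four leaves, but there are only three and the paths
      -- from z to a leaf are unique.
      deg-≤-3 : ∀ z → S z ≡ true → deg G S z ≤ 3
      deg-≤-3 z sz = ≮⇒≥ λ 3<deg → four-neighbours (neighbours S z 4 3<deg)
        where
        four-neighbours : (Σ (List (V G)) λ xs → length xs ≡ 4 × Unique xs × All (Neighbour S z) xs) → ⊥
        four-neighbours (xs , len , unique , nbrs) =
          no-collision (pigeonhole (subst (3 <_) (sym len) ≤-refl) (λ i → index (ends i)))
          where
          w : Fin (length xs) → V G
          w = lookup xs
          to-leaf : ∀ i → PathToLeaf z (w i)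
          to-leaf i = path-to-leaf n (edge z (w i)) 1 (λ { zero _ → proj₂ nbr ; (suc _) (s≤s ()) }) (λ { _ (s≤s ()) })
                        (λ { zero _ → sz ; (suc zero) _ → proj₁ nbr ; (suc (suc _)) (s≤s ()) }) (s≤s z≤n) (m≤n+m n 1)
            where
            nbr = All.lookup nbrs (∈-lookup i)
          ends : ∀ i → LeafIndex (PathToLeaf.g (to-leaf i) (PathToLeaf.L (to-leaf i)))
          ends i = only-leaves _ (PathToLeaf.leaf (to-leaf i))
          no-collision : (Σ (Fin (length xs)) λ i → Σ (Fin (length xs)) λ j → i <ᶠ j × index (ends i) ≡ index (ends j)) → ⊥
          no-collision (i , j , i<j , same) = <-irrefl (cong toℕ (lookup-injective unique i j first-steps)) i<j
            where
            open PathToLeaf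
            first-steps : w i ≡ w j
            first-steps = trans (sym (g1 (to-leaf i)))
              (trans (proj₂ (nb-unique (L (to-leaf i)) (g (to-leaf i)) (L (to-leaf j)) (g (to-leaf j))
                               (gA (to-leaf i)) (gN (to-leaf i)) (gA (to-leaf j)) (gN (to-leaf j))
                               (trans (g0 (to-leaf i)) (sym (g0 (to-leaf j)))) (index-injective (ends i) (ends j) same))
                             1 (1≤L (to-leaf i)))
                     (g1 (to-leaf j)))

      leaf-positive : ∀ {x d} → Leaf G S x → SGeodesic x d → 1 ≤ d
      leaf-positive {d = suc d} _ _ = s≤s z≤n
      leaf-positive {d = zero} (_ , deg-1) P with trans (sym deg-v) (subst (λ y → deg G S y ≡ 1) (trans (sym fd) f0) deg-1)
        where open SGeodesic P
      ... | ()

      interior-deg : ∀ h H t → Adjacent h H → NonBacktracking h H → Inside S h H → 1 ≤ t → t < H → 2 ≤ deg G S (h t)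
      interior-deg h H (suc t) A N I _ lt = deg-≥ S _ ((N t lt ∷ []) ∷ [] ∷ [])
        ((I t (≤-trans (n≤1+n t) (<⇒≤ lt)) , trans (adj-sym _ _) (A t (<⇒≤ lt))) ∷ (I _ lt , A _ lt) ∷ [])

      leaf-not-interior : ∀ {y} → Leaf G S y → ¬ 2 ≤ deg G S y
      leaf-not-interior (_ , deg-1) 2≤deg = <⇒≱ 2≤deg (≤-reflexive deg-1)

      module _ {x x′ L L′} (P : SGeodesic x L) (P′ : SGeodesic x′ L′) where

        open SGeodesic P
        open SGeodesic P′ renaming (f to g; f0 to g0; fd to gd; fA to gA; fN to gN; fI to gI)

        Agree : ℕ → Set
        Agree s = ∀ i → i ≤ s → f i ≡ g i

        agree-to-end : Agree (L ⊓ L′) → Leaf G S x → Leaf G S x′ → x ≢ x′ → ⊥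
        agree-to-end agree leaf-x leaf-x′ x≢x′ with <-cmp L L′
        ... | tri< lt _ _ = leaf-not-interior leaf-x
          (subst (λ y → 2 ≤ deg G S y) (trans (sym (agree L (≤-reflexive (sym (m≤n⇒m⊓n≡m (<⇒≤ lt)))))) fd)
            (interior-deg g L′ L gA gN gI (leaf-positive leaf-x P) lt))
        ... | tri≈ _ refl _ = x≢x′ (trans (sym fd) (trans (agree L (≤-reflexive (sym (⊓-idem L)))) gd))
        ... | tri> _ _ gt = leaf-not-interior leaf-x′
          (subst (λ y → 2 ≤ deg G S y) (trans (agree L′ (≤-reflexive (sym (m≥n⇒m⊓n≡n (<⇒≤ gt))))) gd)
            (interior-deg f L L′ fA fN fI (leaf-positive leaf-x′ P′) gt))

        -- A branch point other than v would have degree at least 3, hence at least 4.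
        split-point : ∀ t → Agree (suc t) → f (2 + t) ≢ g (2 + t) → suc t < L ⊓ L′ → ⊥
        split-point t agree differ lt with deg G S (f (suc t)) ≟ 3
        ... | yes deg-3 = branch≢origin (only-origin _ (fI _ (<⇒≤ s<L)) deg-3)
          where
          s<L : suc t < L
          s<L = ≤-trans lt (m⊓n≤m L L′)
          branch≢origin : f (suc t) ≢ v
          branch≢origin e with trans (sym (nb-prefix-dist f L fA fN (suc t) (<⇒≤ s<L))) (trans (cong₂ dist f0 e) (dist-refl v))
          ... | ()
        ... | no deg≢3 = <⇒≱ (≤∧≢⇒< (deg-≥ S _ unique (back ∷ forward ∷ other ∷ [])) (deg≢3 ∘ sym)) (deg-≤-3 _ (fI _ (<⇒≤ s<L)))
          where
          s<L : suc t < L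
          s<L = ≤-trans lt (m⊓n≤m L L′)
          s<L′ : suc t < L′
          s<L′ = ≤-trans lt (m⊓n≤n L L′)
          back : Neighbour S (f (suc t)) (f t)
          back = fI t (≤-trans (n≤1+n t) (<⇒≤ s<L)) , trans (adj-sym _ _) (fA t (<⇒≤ s<L))
          forward : Neighbour S (f (suc t)) (f (2 + t))
          forward = fI _ s<L , fA _ s<L
          other : Neighbour S (f (suc t)) (g (2 + t))
          other = gI _ s<L′ , subst (λ y → adj y (g (2 + t)) ≡ true) (sym (agree (suc t) ≤-refl)) (gA _ s<L′)
          unique : Unique (f t ∷ f (2 + t) ∷ g (2 + t) ∷ [])
          unique = (fN t s<L ∷ (λ e → gN t s<L′ (trans (sym (agree t (n≤1+n t))) e)) ∷ []) ∷ (differ ∷ []) ∷ [] ∷ []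

        first-steps-distinct : Leaf G S x → Leaf G S x′ → x ≢ x′ → f 1 ≢ g 1
        first-steps-distinct leaf-x leaf-x′ x≢x′ same-first
          with least {P = λ j → L ⊓ L′ ≤ j ⊎ f (suc j) ≢ g (suc j)} (λ j → (L ⊓ L′ ≤? j) ⊎-dec ¬? (f (suc j) ≟ᵛ g (suc j))) _ (inj₁ ≤-refl)
        ... | s , found , before = diverge s s≤m (agree-until before) found
          where
          agree-until : ∀ {s} → (∀ j → j < s → ¬ (L ⊓ L′ ≤ j ⊎ f (suc j) ≢ g (suc j))) → Agree s
          agree-until before zero _ = trans f0 (sym g0)
          agree-until before (suc j) le with f (suc j) ≟ᵛ g (suc j)
          ... | yes e = e
          ... | no ne = ⊥-elim (before j le (inj₂ ne))
          s≤m : s ≤ L ⊓ L′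
          s≤m = ≮⇒≥ (λ m<s → before _ m<s (inj₁ ≤-refl))
          diverge : ∀ s → s ≤ L ⊓ L′ → Agree s → L ⊓ L′ ≤ s ⊎ f (suc s) ≢ g (suc s) → ⊥
          diverge s _ agree (inj₁ m≤s) = agree-to-end (λ i le → agree i (≤-trans le m≤s)) leaf-x leaf-x′ x≢x′
          diverge zero _ _ (inj₂ differ) = differ same-first
          diverge (suc t) s≤m agree (inj₂ differ) with m≤n⇒m<n∨m≡n s≤m
          ... | inj₁ lt = split-point t agree differ lt
          ... | inj₂ s≡m = agree-to-end (λ i le → agree i (≤-trans le (≤-reflexive (sym s≡m)))) leaf-x leaf-x′ x≢x′

      triod-legs : ∀ {da db dc} → Dist G S v a da → Dist G S v b db → Dist G S v c dc →
                   Σ ℕ λ j → da ⊓ db ⊓ dc ≡ suc j × ThreeLegs v j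
      triod-legs {da} {db} {dc} Da Db Dc
        with da ⊓ db ⊓ dc in m≡ | ⊓-glb (⊓-glb (leaf-positive leaf-a Pa) (leaf-positive leaf-b Pb)) (leaf-positive leaf-c Pc)
        where
        Pa = S-geodesic Da
        Pb = S-geodesic Db
        Pc = S-geodesic Dc
      ... | suc j | _ = j , refl ,
        legs-from-feet (first-steps-distinct Pa Pb leaf-a leaf-b a≢b) (first-steps-distinct Pa Pc leaf-a leaf-c a≢c)
                       (first-steps-distinct Pb Pc leaf-b leaf-c b≢c)
                       (foot Pa (subst (_≤ da) m≡ (≤-trans (m⊓n≤m _ dc) (m⊓n≤m da db))))
                       (foot Pb (subst (_≤ db) m≡ (≤-trans (m⊓n≤m _ dc) (m⊓n≤n da db))))
                       (foot Pc (subst (_≤ dc) m≡ (m⊓n≤n _ dc)))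
        where
        Pa = S-geodesic Da
        Pb = S-geodesic Db
        Pc = S-geodesic Dc
        foot : ∀ {x d} (P : SGeodesic x d) → suc j ≤ d → Foot v j (SGeodesic.f P 1)
        foot {d = d} P le = path-foot f d f0 fA fN le
          where open SGeodesic P

    longest-legs : ∀ v → 3 ≤ deg G (full G) v → Σ ℕ λ k → ThreeLegs v k × (∀ j → ThreeLegs v j → j ≤ k)
    longest-legs v le = greatest (ThreeLegs? v) n (legs-from-degree le) (λ j legs → <⇒≤ (ThreeLegs-< legs))

    ℓ₃ : V G → ℕ
    ℓ₃ v with 3 ≤? deg G (full G) v
    ... | yes le = suc (proj₁ (longest-legs v le))
    ... | no _ = 0

    ThreeLegs⇒<ℓ₃ : ∀ v j → ThreeLegs v j → j < ℓ₃ v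
    ThreeLegs⇒<ℓ₃ v j legs with 3 ≤? deg G (full G) v
    ... | yes le = s≤s (proj₂ (proj₂ (longest-legs v le)) j legs)
    ... | no ≱3 = ⊥-elim (≱3 (ThreeLegs⇒degree legs))

    ℓ₃-legs : ∀ v j → ℓ₃ v ≡ suc j → ThreeLegs v j
    ℓ₃-legs v j e with 3 ≤? deg G (full G) v
    ℓ₃-legs v j refl | yes le = proj₁ (proj₂ (longest-legs v le))

    triod⇒legs : ∀ {S v k} → TriodL3 G S v k → Σ ℕ λ j → k ≡ suc j × ThreeLegs v j
    triod⇒legs (a , b , c , T , _ , _ , _ , Da , Db , Dc , k≡) with LegsOfTriod.triod-legs T Da Db Dc
    ... | j , m≡ , legs = j , trans k≡ m≡ , legs

    triod-≤ℓ₃ : ∀ {S v k} → TriodL3 G S v k → k ≤ ℓ₃ v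
    triod-≤ℓ₃ {v = v} T with triod⇒legs T
    ... | j , refl , legs = ThreeLegs⇒<ℓ₃ v j legs

    ℓ₃-IsL3 : ∀ v → IsL3 G v (ℓ₃ v)
    ℓ₃-IsL3 v with 3 ≤? deg G (full G) v
    ... | no ≱3 = inj₁ (≰⇒> ≱3 , refl)
    ... | yes le = inj₂ (le , (TriodOfLegs.S legs , TriodOfLegs.triod legs) , bound)
      where
      longest = longest-legs v le
      legs = proj₁ (proj₂ longest)
      bound : ∀ S k′ → TriodL3 G S v k′ → k′ ≤ suc (proj₁ longest)
      bound S k′ T with triod⇒legs T
      ... | j , refl , legs′ = s≤s (proj₂ (proj₂ longest) j legs′)

    IsL3⇒≤ℓ₃ : ∀ v k → IsL3 G v k → k ≤ ℓ₃ v
    IsL3⇒≤ℓ₃ v k (inj₁ (_ , refl)) = z≤n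
    IsL3⇒≤ℓ₃ v k (inj₂ (_ , (S , T) , _)) = triod-≤ℓ₃ T

    Close⇒dist : ∀ {ρ u w} → Close G ρ u w → dist u w ≤ ρ
    Close⇒dist {ρ} {u} {w} (k , le , W) = ≤-trans (dist-min u w k W) le

    dist⇒Close : ∀ {ρ u w} → dist u w ≤ ρ → Close G ρ u w
    dist⇒Close {ρ} {u} {w} le = dist u w , le , dist-walk u w

    lazy-dist : ∀ {m p} → IsLazyWalk G m p → ∀ {i j} → i ≤ j → j ≤ m → dist (p i) (p j) ≤ j ∸ i
    lazy-dist {m} {p} lazy {i} i≤j j≤m with ≤-split i≤j
    ... | t , refl = subst (dist (p i) (p (i + t)) ≤_) (sym (m+n∸m≡n i t)) (walked t j≤m)
      where
      walked : ∀ t → i + t ≤ m → dist (p i) (p (i + t)) ≤ t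
      walked zero _ = ≤-reflexive (trans (cong (λ z → dist (p i) (p z)) (+-identityʳ i)) (dist-refl _))
      walked (suc t) le = begin
        dist (p i) (p (i + suc t))                           ≤⟨ dist-triangle (p i) (p (i + t)) _ ⟩
        dist (p i) (p (i + t)) + dist (p (i + t)) (p (i + suc t))
          ≤⟨ +-mono-≤ (walked t (≤-trans (+-monoʳ-≤ i (n≤1+n t)) le))
                      (subst (λ z → dist (p (i + t)) (p z) ≤ 1) (sym (+-suc i t)) (dist-step (lazy (i + t) (subst (_≤ m) (+-suc i t) le)))) ⟩
        t + 1                                                ≡⟨ +-comm t 1 ⟩
        suc t                                                ∎
        where open ≤-Reasoning

    lazy-dist-back : ∀ {m p} → IsLazyWalk G m p → ∀ {i j} → j ≤ i → i ≤ m → dist (p i) (p j) ≤ i ∸ j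
    lazy-dist-back lazy j≤i i≤m = ≤-trans (≤-reflexive (dist-sym _ _)) (lazy-dist lazy j≤i i≤m)

    module RobberEscapes {ρ : ℕ} {v₀ : V G} (legs : ThreeLegs v₀ (suc (ρ + ρ)))
                         {m : ℕ} {p : ℕ → V G} (lazy : IsLazyWalk G m p) where

      open TriodOfLegs legs using (K; leg; legs-dist; leg-adjacent)

      NearLeaf : ℕ → Set
      NearLeaf a = a ≤ m × Σ (Fin 3) λ j → dist (p a) (leg j K) ≤ ρ

      NearLeaf? : ∀ a → Dec (NearLeaf a)
      NearLeaf? a = (a ≤? m) ×-dec any? (λ j → dist (p a) (leg j K) ≤? ρ)

      label : ∀ {a} → NearLeaf a → Fin 3
      label near = proj₁ (proj₂ near)

      out-of-reach : ∀ {a} (near : NearLeaf a) c → c ≢ label near → ∀ δ x → δ ≤ K → dist (p a) x ≤ suc δ →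
                     ¬ dist x (leg c δ) ≤ ρ
      out-of-reach {a} near c c≢j δ x δ≤K ax xc = <⇒≱ (≤-reflexive (budget ρ δ)) (begin
        K + δ                                           ≡⟨ sym (legs-dist (c≢j ∘ sym) K δ ≤-refl δ≤K) ⟩
        dist (leg j K) (leg c δ)                        ≤⟨ dist-triangle _ (p a) _ ⟩
        dist (leg j K) (p a) + dist (p a) (leg c δ)     ≤⟨ +-mono-≤ (≤-trans (≤-reflexive (dist-sym _ _)) (proj₂ (proj₂ near)))
                                                                    (≤-trans (dist-triangle (p a) x _) (+-mono-≤ ax xc)) ⟩
        ρ + (suc δ + ρ)                                 ∎)
        where
        open ≤-Reasoning
        j = label near
        budget : ∀ ρ δ → suc (ρ + (suc δ + ρ)) ≡ suc (suc (ρ + ρ)) + δ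
        budget = solve-∀

      other-leg : Maybe (Fin 3) → Maybe (Fin 3) → Fin 3
      other-leg (just zero) (just (suc zero)) = suc (suc zero)
      other-leg (just (suc zero)) (just zero) = suc (suc zero)
      other-leg (just zero) _ = suc zero
      other-leg _ (just zero) = suc zero
      other-leg _ _ = zero

      other-leg-fresh : ∀ x y → just (other-leg x y) ≢ x × just (other-leg x y) ≢ y
      other-leg-fresh (just zero) (just zero) = (λ ()) , (λ ())
      other-leg-fresh (just zero) (just (suc zero)) = (λ ()) , (λ ())
      other-leg-fresh (just zero) (just (suc (suc zero))) = (λ ()) , (λ ())
      other-leg-fresh (just zero) nothing = (λ ()) , (λ ())
      other-leg-fresh (just (suc zero)) (just zero) = (λ ()) , (λ ())
      other-leg-fresh (just (suc zero)) (just (suc zero)) = (λ ()) , (λ ())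
      other-leg-fresh (just (suc zero)) (just (suc (suc zero))) = (λ ()) , (λ ())
      other-leg-fresh (just (suc zero)) nothing = (λ ()) , (λ ())
      other-leg-fresh (just (suc (suc zero))) (just zero) = (λ ()) , (λ ())
      other-leg-fresh (just (suc (suc zero))) (just (suc zero)) = (λ ()) , (λ ())
      other-leg-fresh (just (suc (suc zero))) (just (suc (suc zero))) = (λ ()) , (λ ())
      other-leg-fresh (just (suc (suc zero))) nothing = (λ ()) , (λ ())
      other-leg-fresh nothing (just zero) = (λ ()) , (λ ())
      other-leg-fresh nothing (just (suc zero)) = (λ ()) , (λ ())
      other-leg-fresh nothing (just (suc (suc zero))) = (λ ()) , (λ ())
      other-leg-fresh nothing nothing = (λ ()) , (λ ())

      Moment : Set
      Moment = Σ ℕ NearLeaf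

      note : ∀ t → Dec (NearLeaf t) → Maybe Moment → Maybe Moment
      note t (yes near) _ = just (t , near)
      note t (no _) r = r

      last-near : ℕ → Maybe Moment
      last-near zero = note 0 (NearLeaf? 0) nothing
      last-near (suc t) = note (suc t) (NearLeaf? (suc t)) (last-near t)

      next-near-within : ℕ → ℕ → Maybe Moment
      next-near-within zero t = note t (NearLeaf? t) nothing
      next-near-within (suc fuel) t = note t (NearLeaf? t) (next-near-within fuel (suc t))

      next-near : ℕ → Maybe Moment
      next-near t = next-near-within (m ∸ t) t

      last-near-now : ∀ t (near : NearLeaf t) → NearLeaf? t ≡ yes near → last-near t ≡ just (t , near)
      last-near-now zero near e rewrite e = refl
      last-near-now (suc t) near e rewrite e = refl

      last-near-suc : ∀ t → ¬ NearLeaf (suc t) → last-near (suc t) ≡ last-near t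
      last-near-suc t far with NearLeaf? (suc t)
      ... | yes near = ⊥-elim (far near)
      ... | no _ = refl

      last-near-≤ : ∀ t {a near} → last-near t ≡ just (a , near) → a ≤ t
      last-near-≤ zero e with NearLeaf? 0
      last-near-≤ zero refl | yes _ = z≤n
      last-near-≤ zero () | no _
      last-near-≤ (suc t) e with NearLeaf? (suc t)
      last-near-≤ (suc t) refl | yes _ = ≤-refl
      ... | no _ = m≤n⇒m≤1+n (last-near-≤ t e)

      next-near-within-now : ∀ fuel t (near : NearLeaf t) → NearLeaf? t ≡ yes near → next-near-within fuel t ≡ just (t , near)
      next-near-within-now zero t near e rewrite e = refl
      next-near-within-now (suc fuel) t near e rewrite e = refl

      next-near-within-≥ : ∀ fuel t {a near} → next-near-within fuel t ≡ just (a , near) → t ≤ a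
      next-near-within-≥ zero t e with NearLeaf? t
      next-near-within-≥ zero t refl | yes _ = ≤-refl
      next-near-within-≥ zero t () | no _
      next-near-within-≥ (suc fuel) t e with NearLeaf? t
      next-near-within-≥ (suc fuel) t refl | yes _ = ≤-refl
      ... | no _ = ≤-trans (n≤1+n t) (next-near-within-≥ fuel (suc t) e)

      next-near-now : ∀ t (near : NearLeaf t) → NearLeaf? t ≡ yes near → next-near t ≡ just (t , near)
      next-near-now t = next-near-within-now (m ∸ t) t

      next-near-≥ : ∀ t {a near} → next-near t ≡ just (a , near) → t ≤ a
      next-near-≥ t = next-near-within-≥ (m ∸ t) t

      next-near-suc : ∀ t → t < m → ¬ NearLeaf t → next-near t ≡ next-near (suc t)
      next-near-suc t t<m far rewrite +-∸-assoc 1 t<m with NearLeaf? t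
      ... | yes near = ⊥-elim (far near)
      ... | no _ = refl

      label? : Maybe Moment → Maybe (Fin 3)
      label? (just (a , near)) = just (label near)
      label? nothing = nothing

      since : ℕ → Maybe Moment → ℕ
      since t (just (a , _)) = t ∸ a
      since t nothing = K

      until : ℕ → Maybe Moment → ℕ
      until t (just (a , _)) = a ∸ t
      until t nothing = K

      depth : ℕ → ℕ
      depth t = K ⊓ since t (last-near t) ⊓ until t (next-near t)

      hideout : ℕ → Fin 3
      hideout t = other-leg (label? (last-near t)) (label? (next-near t))

      robber-at : ∀ t → Dec (NearLeaf t) → V G
      robber-at t (yes _) = v₀
      robber-at t (no _) = leg (hideout t) (depth t)

      robber : ℕ → V G
      robber t = robber-at t (NearLeaf? t)

      depth-≤ : ∀ t → depth t ≤ K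
      depth-≤ t = ≤-trans (m⊓n≤m _ _) (m⊓n≤m _ _)

      DepthCase : ℕ → Maybe Moment → Maybe Moment → ℕ → Set
      DepthCase t l r d = (Σ Moment λ am → l ≡ just am × d ≡ t ∸ proj₁ am)
                        ⊎ (Σ Moment λ am → r ≡ just am × d ≡ proj₁ am ∸ t)
                        ⊎ d ≡ K

      depth-cases : ∀ t l r → DepthCase t l r (K ⊓ since t l ⊓ until t r)
      depth-cases t l r with ⊓-sel (K ⊓ since t l) (until t r)
      ... | inj₂ e = by-next r e
        where
        by-next : ∀ r → K ⊓ since t l ⊓ until t r ≡ until t r → DepthCase t l r (K ⊓ since t l ⊓ until t r)
        by-next (just am) e = inj₂ (inj₁ (am , refl , e))
        by-next nothing e = inj₂ (inj₂ e)
      ... | inj₁ e with ⊓-sel K (since t l)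
      ...   | inj₁ e₂ = inj₂ (inj₂ (trans e e₂))
      ...   | inj₂ e₂ = by-last l (trans e e₂)
        where
        by-last : ∀ l → K ⊓ since t l ⊓ until t r ≡ since t l → DepthCase t l r (K ⊓ since t l ⊓ until t r)
        by-last (just am) e = inj₁ (am , refl , e)
        by-last nothing e = inj₂ (inj₂ e)

      Safe : ℕ → V G → Set
      Safe t x = ¬ dist (p t) x ≤ ρ × (t < m → ¬ dist (p (suc t)) x ≤ ρ)

      hideout-last : ∀ t {a near} → last-near t ≡ just (a , near) → hideout t ≢ label near
      hideout-last t e h≡ = proj₁ (other-leg-fresh (label? (last-near t)) (label? (next-near t)))
                              (trans (cong just h≡) (cong label? (sym e)))

      hideout-next : ∀ t {a near} → next-near t ≡ just (a , near) → hideout t ≢ label near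
      hideout-next t e h≡ = proj₂ (other-leg-fresh (label? (last-near t)) (label? (next-near t)))
                              (trans (cong just h≡) (cong label? (sym e)))

      safe-hidden : ∀ t → t ≤ m → ¬ NearLeaf t → Safe t (leg (hideout t) (depth t))
      safe-hidden t t≤m far with depth-cases t (last-near t) (next-near t)
      ... | inj₁ ((a , near) , last , δ≡) =
        out-of-reach near _ (hideout-last t last) (depth t) (p t) (depth-≤ t)
          (≤-trans (lazy-dist lazy a≤t t≤m) (≤-trans (≤-reflexive (sym δ≡)) (n≤1+n _))) ,
        λ t<m → out-of-reach near _ (hideout-last t last) (depth t) (p (suc t)) (depth-≤ t)
          (≤-trans (lazy-dist lazy (m≤n⇒m≤1+n a≤t) t<m) (≤-reflexive (trans (+-∸-assoc 1 a≤t) (cong suc (sym δ≡)))))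
        where
        a≤t = last-near-≤ t last
      ... | inj₂ (inj₁ ((a , near) , next , δ≡)) =
        out-of-reach near _ (hideout-next t next) (depth t) (p t) (depth-≤ t)
          (≤-trans (lazy-dist-back lazy t≤a (proj₁ near)) (≤-trans (≤-reflexive (sym δ≡)) (n≤1+n _))) ,
        λ t<m → out-of-reach near _ (hideout-next t next) (depth t) (p (suc t)) (depth-≤ t)
          (≤-trans (lazy-dist-back lazy t<a (proj₁ near)) (≤-trans (∸-monoʳ-≤ a (n≤1+n t)) (≤-trans (≤-reflexive (sym δ≡)) (n≤1+n _))))
        where
        t≤a = next-near-≥ t next
        t<a : t < a
        t<a = ≤∧≢⇒< t≤a (λ { refl → far near })
      ... | inj₂ (inj₂ δ≡K) = (λ close → far (t≤m , hideout t , subst (λ d → dist (p t) (leg (hideout t) d) ≤ ρ) δ≡K close)) , next-step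
        where
        next-step : t < m → ¬ dist (p (suc t)) (leg (hideout t) (depth t)) ≤ ρ
        next-step t<m close with NearLeaf? (suc t) in e
        ... | no far′ = far′ (t<m , hideout t , subst (λ d → dist (p (suc t)) (leg (hideout t) d) ≤ ρ) δ≡K close)
        ... | yes near′ = out-of-reach near′ _ (hideout-next t next) (depth t) (p (suc t)) (depth-≤ t)
                            (≤-trans (≤-reflexive (dist-refl _)) z≤n) close
          where
          next : next-near t ≡ just (suc t , near′)
          next = trans (next-near-suc t t<m far) (next-near-now (suc t) near′ e)

      safe-centre : ∀ t → NearLeaf t → Safe t v₀
      safe-centre t near = out-of-reach near c c≢ 0 (p t) z≤n (≤-trans (≤-reflexive (dist-refl _)) z≤n) ,
                           λ t<m → out-of-reach near c c≢ 0 (p (suc t)) z≤n (dist-step (lazy t t<m))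
        where
        c = other-leg (just (label near)) nothing
        c≢ : c ≢ label near
        c≢ e = proj₁ (other-leg-fresh (just (label near)) nothing) (cong just e)

      safe : ∀ t → t ≤ m → Safe t (robber t)
      safe t t≤m with NearLeaf? t
      ... | yes near = safe-centre t near
      ... | no far = safe-hidden t t≤m far

      Near : ℕ → ℕ → Set
      Near a b = a ≤ suc b × b ≤ suc a

      Near-refl : ∀ a → Near a a
      Near-refl a = n≤1+n a , n≤1+n a

      Near-suc : ∀ a → Near a (suc a)
      Near-suc a = ≤-trans (n≤1+n a) (n≤1+n (suc a)) , ≤-refl

      Near-sym : ∀ {a b} → Near a b → Near b a
      Near-sym (ab , ba) = ba , ab

      Near-⊓ : ∀ {a b a′ b′} → Near a a′ → Near b b′ → Near (a ⊓ b) (a′ ⊓ b′)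
      Near-⊓ {a} {b} {a′} {b′} (aa′ , a′a) (bb′ , b′b) =
        ⊓-glb (≤-trans (m⊓n≤m a b) aa′) (≤-trans (m⊓n≤n a b) bb′) ,
        ⊓-glb (≤-trans (m⊓n≤m a′ b′) a′a) (≤-trans (m⊓n≤n a′ b′) b′b)

      leg-step : ∀ c d d′ → d ≤ K → d′ ≤ K → Near d d′ → leg c d ≡ leg c d′ ⊎ adj (leg c d) (leg c d′) ≡ true
      leg-step c d d′ d≤K d′≤K (dd′ , d′d) with <-cmp d d′
      ... | tri≈ _ refl _ = inj₁ refl
      ... | tri< lt _ _ = inj₂ (subst (λ z → adj (leg c d) (leg c z) ≡ true) (≤-antisym lt d′d) (leg-adjacent c d (≤-trans lt d′≤K)))
      ... | tri> _ _ gt = inj₂ (subst (λ z → adj (leg c z) (leg c d′) ≡ true) (≤-antisym gt dd′)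
                                  (trans (adj-sym _ _) (leg-adjacent c d′ (≤-trans gt d≤K))))

      since-suc : ∀ t l → (∀ {a near} → l ≡ just (a , near) → a ≤ t) → Near (since t l) (since (suc t) l)
      since-suc t (just (a , _)) a≤t = subst (Near (t ∸ a)) (sym (+-∸-assoc 1 (a≤t refl))) (Near-suc _)
      since-suc t nothing _ = Near-refl K

      until-suc : ∀ t r → (∀ {a near} → r ≡ just (a , near) → suc t ≤ a) → Near (until t r) (until (suc t) r)
      until-suc t (just (a , _)) t<a = subst (λ z → Near z (a ∸ suc t)) (sym (∸-suc a t (t<a refl))) (Near-sym (Near-suc _))
        where
        ∸-suc : ∀ a t → suc t ≤ a → a ∸ t ≡ suc (a ∸ suc t)
        ∸-suc (suc a) zero _ = refl
        ∸-suc (suc a) (suc t) (s≤s le) = ∸-suc a t le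
      until-suc t nothing _ = Near-refl K

      same-hideout : ∀ t → t < m → ¬ NearLeaf t → ¬ NearLeaf (suc t) → hideout t ≡ hideout (suc t)
      same-hideout t t<m far far′ rewrite next-near-suc t t<m far | last-near-suc t far′ = refl

      depth-near : ∀ t → t < m → ¬ NearLeaf t → ¬ NearLeaf (suc t) → Near (depth t) (depth (suc t))
      depth-near t t<m far far′ rewrite next-near-suc t t<m far | last-near-suc t far′ =
        Near-⊓ (Near-⊓ (Near-refl K) (since-suc t (last-near t) (last-near-≤ t)))
               (until-suc t (next-near (suc t)) (next-near-≥ (suc t)))

      robber-lazy : IsLazyWalk G m robber
      robber-lazy t t<m with NearLeaf? t in e₁ | NearLeaf? (suc t) in e₂
      ... | yes _ | yes _ = inj₁ refl
      ... | yes near | no far′ = leg-step (hideout (suc t)) 0 (depth (suc t)) z≤n (depth-≤ (suc t)) (z≤n , ≤1)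
        where
        last : last-near (suc t) ≡ just (t , near)
        last = trans (last-near-suc t far′) (last-near-now t near e₁)
        ≤1 : depth (suc t) ≤ 1
        ≤1 = ≤-trans (m⊓n≤m _ _) (≤-trans (m⊓n≤n K _)
               (≤-reflexive (trans (cong (since (suc t)) last) (trans (+-∸-assoc 1 (≤-refl {t})) (cong suc (n∸n≡0 t))))))
      ... | no far | yes near′ = leg-step (hideout t) (depth t) 0 (depth-≤ t) z≤n (≤1 , z≤n)
        where
        next : next-near t ≡ just (suc t , near′)
        next = trans (next-near-suc t t<m far) (next-near-now (suc t) near′ e₂)
        ≤1 : depth t ≤ 1
        ≤1 = ≤-trans (m⊓n≤n _ _) (≤-reflexive (trans (cong (until t) next) (trans (+-∸-assoc 1 (≤-refl {t})) (cong suc (n∸n≡0 t)))))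
      ... | no far | no far′ =
        subst (λ c → leg (hideout t) (depth t) ≡ leg c (depth (suc t)) ⊎ adj (leg (hideout t) (depth t)) (leg c (depth (suc t))) ≡ true)
              (same-hideout t t<m far far′)
              (leg-step (hideout t) (depth t) (depth (suc t)) (depth-≤ t) (depth-≤ (suc t)) (depth-near t t<m far far′))

      robber-safe : ¬ Captures G ρ m p robber
      robber-safe (inj₁ (i , i≤m , close)) = proj₁ (safe i i≤m) (Close⇒dist close)
      robber-safe (inj₂ (i , i<m , close)) = proj₂ (safe i (<⇒≤ i<m)) i<m (Close⇒dist close)

    module LongestPath {x₀ y₀ : V G} (a₀ : adj x₀ y₀ ≡ true) where

      EdgeRay : ℕ → Set
      EdgeRay L = Σ (V G) λ x → Σ (V G) λ y → adj x y ≡ true × Ray x y L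

      EdgeRay? : ∀ L → Dec (EdgeRay L)
      EdgeRay? L = any? λ x → any? λ y → (adj x y ≟ᵇ true) ×-dec ray? L x y

      EdgeRay-< : ∀ {L} → EdgeRay L → L < n
      EdgeRay-< {L} (x , y , a , R) with ray→path a R
      ... | f , _ , A , N = <-trans (n<1+n L) (nb-length-< (cons x f) (suc L) A N)

      abstract
        longest : Σ ℕ λ k → EdgeRay k × (∀ j → EdgeRay j → j ≤ k)
        longest = greatest EdgeRay? n (x₀ , y₀ , a₀ , stop) (λ j R → <⇒≤ (EdgeRay-< R))

      L : ℕ
      L = suc (proj₁ longest)

      private
        longest-path = ray→path (proj₁ (proj₂ (proj₂ (proj₁ (proj₂ longest))))) (proj₂ (proj₂ (proj₂ (proj₁ (proj₂ longest)))))

      r : V G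
      r = proj₁ (proj₁ (proj₂ longest))

      spine : Path
      spine = cons r (proj₁ longest-path)

      spine-adjacent : Adjacent spine L
      spine-adjacent = proj₁ (proj₂ (proj₂ longest-path))

      spine-nb : NonBacktracking spine L
      spine-nb = proj₂ (proj₂ (proj₂ longest-path))

      spine-maximal : ∀ f L′ → Adjacent f L′ → NonBacktracking f L′ → L′ ≤ L
      spine-maximal f zero A N = z≤n
      spine-maximal f (suc L′) A N = s≤s (proj₂ (proj₂ longest) L′ (f 0 , f 1 , A 0 (s≤s z≤n) , path→ray f L′ A N))

      spine-dist : ∀ i → i ≤ L → dist r (spine i) ≡ i
      spine-dist = nb-prefix-dist spine L spine-adjacent spine-nb

      module _ {i rest : ℕ} (L≡ : L ≡ i + rest) where

        suffix-adjacent : Adjacent (shift i spine) rest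
        suffix-adjacent = Adjacent-shift spine i (subst (Adjacent spine) L≡ spine-adjacent)

        suffix-nb : NonBacktracking (shift i spine) rest
        suffix-nb = NonBacktracking-shift spine i (subst (NonBacktracking spine) L≡ spine-nb)

        -- A non-backtracking path f leaving spine i can replace the spine before or after spine i.
        branch-≤-before : ∀ f ℓ → f 0 ≡ spine i → Adjacent f ℓ → NonBacktracking f ℓ → f 1 ≢ spine (suc i) → ℓ ≤ i
        branch-≤-before f ℓ f0 A N f1≢ = +-cancelʳ-≤ rest ℓ i (subst (ℓ + rest ≤_) L≡ (spine-maximal _ (ℓ + rest)
          (Adjacent-append (reverse f ℓ) ℓ (shift i spine) rest (Adjacent-reverse f ℓ A) suffix-adjacent join)
          (NonBacktracking-append (reverse f ℓ) ℓ (shift i spine) rest (NonBacktracking-reverse f ℓ N) suffix-nb join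
            (λ { b refl _ e → f1≢ (trans (cong f (sym (m+n∸n≡m 1 b))) (trans e (cong spine (+-comm i 1)))) }))))
          where
          join : reverse f ℓ ℓ ≡ shift i spine 0
          join = trans (reverse-end f ℓ) (trans f0 (sym (cong spine (+-identityʳ i))))

        branch-≤-after : ∀ f ℓ → f 0 ≡ spine i → Adjacent f ℓ → NonBacktracking f ℓ → (∀ b → i ≡ suc b → spine b ≢ f 1) → ℓ ≤ rest
        branch-≤-after f ℓ f0 A N back≢ = +-cancelˡ-≤ i ℓ rest (subst (i + ℓ ≤_) L≡ (spine-maximal _ (i + ℓ)
          (Adjacent-append spine i f ℓ (Adjacent-≤ spine i≤L spine-adjacent) A (sym f0))
          (NonBacktracking-append spine i f ℓ (NonBacktracking-≤ spine i≤L spine-nb) N (sym f0) (λ b e _ → back≢ b e))))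
          where
          i≤L : i ≤ L
          i≤L = subst (i ≤_) (sym L≡) (m≤m+n i rest)

      -- A deep subtree hanging off the spine at spine i would, by maximality of the spine, leave at
      -- least as much spine on either side of it: three long legs at spine i.
      side-depth : ∀ {k} → (∀ v → ¬ ThreeLegs v k) → ∀ i → i ≤ L →
                   ∀ s → adj (spine i) s ≡ true → dist r s ≡ suc (dist r (spine i)) → s ≢ spine (suc i) →
                   ∀ x → InSubtree r s x → dist s x < k
      side-depth {k} no-legs i i≤L s a rs s≢next x in-s with suc (dist s x) ≤? k | ≤-split i≤L
      ... | yes lt | _ = lt
      ... | no ≰ | rest , L≡ = ⊥-elim (no-legs (spine i) (legs-from-feet back≢fwd back≢down fwd≢down
            (path-foot back i refl (Adjacent-reverse spine i (Adjacent-≤ spine i≤L spine-adjacent))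
                                   (NonBacktracking-reverse spine i (NonBacktracking-≤ spine i≤L spine-nb)) (≤-trans k<ℓ ℓ≤i))
            (path-foot (shift i spine) rest (cong spine (+-identityʳ i)) (suffix-adjacent L≡) (suffix-nb L≡) (≤-trans k<ℓ ℓ≤rest))
            (path-foot down ℓ refl down-adjacent down-nb k<ℓ)))
        where
        ℓ = suc (dist s x)
        k<ℓ : suc k ≤ ℓ
        k<ℓ = s≤s (≤-pred (≰⇒> ≰))
        back = reverse spine i
        down = cons (spine i) (geodesic s x)
        down-adjacent : Adjacent down ℓ
        down-adjacent zero _ = subst (λ z → adj (spine i) z ≡ true) (sym (geodesic-start s x)) a
        down-adjacent (suc j) (s≤s lt) = geodesic-adjacent s x j lt
        down-nb : NonBacktracking down ℓ
        down-nb = geodesic⇒NonBacktracking down ℓ down-adjacent (λ _ _ → refl)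
          (λ j W → subst (_≤ j) (proj₂ (InSubtree-child r a rs in-s))
                     (dist-min (spine i) x j (subst (λ z → Walk G (full G) (spine i) z j) (geodesic-end s x) W)))
        ℓ≤i : ℓ ≤ i
        ℓ≤i = branch-≤-before L≡ down ℓ refl down-adjacent down-nb (λ e → s≢next (trans (sym (geodesic-start s x)) e))
        ℓ≤rest : ℓ ≤ rest
        ℓ≤rest = branch-≤-after L≡ down ℓ refl down-adjacent down-nb λ b i≡ e →
          m≢1+n+m b {1} (trans (sym (spine-dist b (≤-trans (n≤1+n b) (subst (_≤ L) i≡ i≤L))))
            (trans (cong (dist r) (trans e (geodesic-start s x))) (trans rs (cong suc (trans (spine-dist i i≤L) i≡)))))
        not-back : ∀ y → dist r y ≡ suc i → back 1 ≢ y
        not-back y ry e = <⇒≱ (s≤s (m∸n≤m i 1))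
          (≤-reflexive (trans (sym ry) (trans (cong (dist r) (sym e)) (spine-dist (i ∸ 1) (≤-trans (m∸n≤m i 1) i≤L)))))
        back≢fwd : back 1 ≢ shift i spine 1
        back≢fwd e = not-back (spine (suc i)) (spine-dist (suc i) i<L) (trans e (cong spine (+-comm i 1)))
          where
          i<L : suc i ≤ L
          i<L = subst (suc i ≤_) (sym L≡) (subst (_≤ i + rest) (+-comm i 1) (+-monoʳ-≤ i (≤-trans (s≤s z≤n) ℓ≤rest)))
        back≢down : back 1 ≢ down 1
        back≢down e = not-back s (trans rs (cong suc (spine-dist i i≤L))) (trans e (geodesic-start s x))
        fwd≢down : shift i spine 1 ≢ down 1
        fwd≢down e = s≢next (trans (sym (geodesic-start s x)) (trans (sym e) (cong spine (+-comm i 1))))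

    child? : ∀ s excluded w → Dec (adj s w ≡ true × w ∉ excluded)
    child? s excluded w = (adj s w ≟ᵇ true) ×-dec ¬? (w ∈? excluded)

    children : V G → List (V G) → List (V G)
    children s excluded = filter (child? s excluded) (allFin n)

    children-adj : ∀ s xs {w} → w ∈ children s xs → adj s w ≡ true
    children-adj s xs w∈ = proj₁ (proj₂ (∈-filter⁻ (child? s xs) {xs = allFin n} w∈))

    child∈children : ∀ s xs {w} → adj s w ≡ true → w ∉ xs → w ∈ children s xs
    child∈children s xs a w∉ = ∈-filter⁺ (child? s xs) (∈-allFin _) (a , w∉)

    -- tour b s par: depth-first walk from s back to s through the subtree of s (away from par), down to depth b.
    mutual
      tour : ℕ → V G → V G → Path
      tour zero s par = λ _ → s
      tour (suc b) s par = tours b s (children s (par ∷ []))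

      tour-length : ℕ → V G → V G → ℕ
      tour-length zero s par = 0
      tour-length (suc b) s par = tours-length b s (children s (par ∷ []))

      tours : ℕ → V G → List (V G) → Path
      tours b s [] = λ _ → s
      tours b s (w ∷ ws) = append (excursion b s w) (excursion-length b s w) (tours b s ws)

      tours-length : ℕ → V G → List (V G) → ℕ
      tours-length b s [] = 0
      tours-length b s (w ∷ ws) = excursion-length b s w + tours-length b s ws

      excursion : ℕ → V G → V G → Path
      excursion b s w = cons s (extend (tour b w s) (tour-length b w s) s)

      excursion-length : ℕ → V G → V G → ℕ
      excursion-length b s w = suc (suc (tour-length b w s))

    excursion-end : ∀ b s w → excursion b s w (excursion-length b s w) ≡ s
    excursion-end b s w = extend-end (tour b w s) (tour-length b w s) s

    excursion-inner : ∀ b s w j → j ≤ tour-length b w s → excursion b s w (suc j) ≡ tour b w s j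
    excursion-inner b s w j le = extend-≤ (tour b w s) (tour-length b w s) s j le

    mutual
      tour-start : ∀ b s par → tour b s par 0 ≡ s
      tour-start zero s par = refl
      tour-start (suc b) s par = tours-start b s (children s (par ∷ []))

      tours-start : ∀ b s ws → tours b s ws 0 ≡ s
      tours-start b s [] = refl
      tours-start b s (w ∷ ws) = append-≤ (excursion b s w) (excursion-length b s w) (tours b s ws) 0 z≤n (tours-join b s w ws)

      tours-join : ∀ b s w ws → excursion b s w (excursion-length b s w) ≡ tours b s ws 0
      tours-join b s w ws = trans (excursion-end b s w) (sym (tours-start b s ws))

    tour-end : ∀ b s par → tour b s par (tour-length b s par) ≡ s
    tours-end : ∀ b s ws → tours b s ws (tours-length b s ws) ≡ s
    tour-end zero s par = refl
    tour-end (suc b) s par = tours-end b s (children s (par ∷ []))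
    tours-end b s [] = refl
    tours-end b s (w ∷ ws) = trans (append-+ (excursion b s w) (excursion-length b s w) (tours b s ws) (tours-length b s ws)) (tours-end b s ws)

    mutual
      tour-adjacent : ∀ b s par → Adjacent (tour b s par) (tour-length b s par)
      tour-adjacent zero s par i ()
      tour-adjacent (suc b) s par = tours-adjacent b s (children s (par ∷ [])) (children-adj s (par ∷ []))

      tours-adjacent : ∀ b s ws → (∀ {w} → w ∈ ws → adj s w ≡ true) → Adjacent (tours b s ws) (tours-length b s ws)
      tours-adjacent b s [] _ i ()
      tours-adjacent b s (w ∷ ws) adj-ws =
        Adjacent-append (excursion b s w) (excursion-length b s w) (tours b s ws) (tours-length b s ws)
          (excursion-adjacent b s w (adj-ws (here refl))) (tours-adjacent b s ws (adj-ws ∘ there)) (tours-join b s w ws)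

      excursion-adjacent : ∀ b s w → adj s w ≡ true → Adjacent (excursion b s w) (excursion-length b s w)
      excursion-adjacent b s w a zero _ =
        subst (λ z → adj s z ≡ true) (sym (trans (extend-≤ (tour b w s) (tour-length b w s) s 0 z≤n) (tour-start b w s))) a
      excursion-adjacent b s w a (suc i) (s≤s lt) = Adjacent-extend (tour b w s) (tour-length b w s) s (tour-adjacent b w s)
        (subst (λ z → adj z s ≡ true) (sym (tour-end b w s)) (trans (adj-sym w s) a)) i lt

    mutual
      tour-dist : ∀ b s par j → j ≤ tour-length b s par → dist s (tour b s par j) ≤ b
      tour-dist zero s par j le = ≤-reflexive (dist-refl s)
      tour-dist (suc b) s par j le = tours-dist b s (children s (par ∷ [])) (children-adj s (par ∷ [])) j le

      tours-dist : ∀ b s ws → (∀ {w} → w ∈ ws → adj s w ≡ true) → ∀ j → j ≤ tours-length b s ws → dist s (tours b s ws j) ≤ suc b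
      tours-dist b s [] _ j le = ≤-trans (≤-reflexive (dist-refl s)) z≤n
      tours-dist b s (w ∷ ws) adj-ws j le with ≤-total j (excursion-length b s w)
      ... | inj₁ j≤ = subst (λ z → dist s z ≤ suc b)
                        (sym (append-≤ (excursion b s w) (excursion-length b s w) (tours b s ws) j j≤ (tours-join b s w ws)))
                        (excursion-dist b s w (adj-ws (here refl)) j j≤)
      ... | inj₂ ≥j with ≤-split ≥j
      ...   | j′ , refl = subst (λ z → dist s z ≤ suc b) (sym (append-+ (excursion b s w) (excursion-length b s w) (tours b s ws) j′))
                            (tours-dist b s ws (adj-ws ∘ there) j′ (+-cancelˡ-≤ (excursion-length b s w) j′ _ le))

      excursion-dist : ∀ b s w → adj s w ≡ true → ∀ j → j ≤ excursion-length b s w → dist s (excursion b s w j) ≤ suc b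
      excursion-dist b s w a zero le = ≤-trans (≤-reflexive (dist-refl s)) z≤n
      excursion-dist b s w a (suc j) (s≤s le) with m≤n⇒m<n∨m≡n le
      ... | inj₁ (s≤s l) = subst (λ z → dist s z ≤ suc b) (sym (excursion-inner b s w j l))
                             (≤-trans (dist-triangle s w (tour b w s j)) (+-mono-≤ (dist-adj a) (tour-dist b w s j l)))
      ... | inj₂ refl = subst (λ z → dist s z ≤ suc b) (sym (excursion-end b s w)) (≤-trans (≤-reflexive (dist-refl s)) z≤n)

    excursion-in-tours : ∀ b s ws c → c ∈ ws → Σ ℕ λ o → o + excursion-length b s c ≤ tours-length b s ws ×
                         (∀ j → j ≤ excursion-length b s c → tours b s ws (o + j) ≡ excursion b s c j)
    excursion-in-tours b s (w ∷ ws) c (here refl) = 0 , m≤m+n _ _ ,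
      λ j le → append-≤ (excursion b s c) (excursion-length b s c) (tours b s ws) j le (tours-join b s c ws)
    excursion-in-tours b s (w ∷ ws) c (there c∈) with excursion-in-tours b s ws c c∈
    ... | o , bound , agree = excursion-length b s w + o ,
          subst (_≤ excursion-length b s w + tours-length b s ws) (sym (+-assoc (excursion-length b s w) o _))
            (+-monoʳ-≤ (excursion-length b s w) bound) ,
          λ j le → trans (cong (tours b s (w ∷ ws)) (+-assoc (excursion-length b s w) o j))
                     (trans (append-+ (excursion b s w) (excursion-length b s w) (tours b s ws) (o + j)) (agree j le))

    module Pursuit (ρ : ℕ) (r : V G) (p robber : ℕ → V G) where

      Caught : ℕ → ℕ → Set
      Caught j k = (Σ ℕ λ i → j ≤ i × i ≤ k × dist (p i) (robber i) ≤ ρ)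
                 ⊎ (Σ ℕ λ i → j ≤ i × i < k × dist (p (suc i)) (robber i) ≤ ρ)

      LazyOn : ℕ → ℕ → Set
      LazyOn j k = ∀ i → j ≤ i → i < k → robber i ≡ robber (suc i) ⊎ adj (robber i) (robber (suc i)) ≡ true

      Caught-mono : ∀ {j k j′ k′} → j ≤ j′ → k′ ≤ k → Caught j′ k′ → Caught j k
      Caught-mono jj kk (inj₁ (i , a , b , c)) = inj₁ (i , ≤-trans jj a , ≤-trans b kk , c)
      Caught-mono jj kk (inj₂ (i , a , b , c)) = inj₂ (i , ≤-trans jj a , ≤-trans b kk , c)

      LazyOn-mono : ∀ {j k j′ k′} → j ≤ j′ → k′ ≤ k → LazyOn j k → LazyOn j′ k′
      LazyOn-mono jj kk lazy i a b = lazy i (≤-trans jj a) (≤-trans b kk)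

      caught-here : ∀ {j k} i → j ≤ i → i ≤ k → p i ≡ robber i → Caught j k
      caught-here i j≤i i≤k same = inj₁ (i , j≤i , i≤k , ≤-trans (≤-reflexive (trans (cong (dist (p i)) (sym same)) (dist-refl _))) z≤n)

      -- The only way out of the subtree of c is through q.
      trapped : ∀ q c o len → adj q c ≡ true → dist r c ≡ suc (dist r q) → LazyOn o (o + len) →
                InSubtree r c (robber o) → (∀ t → o ≤ t → t ≤ o + len → robber t ≡ q → Caught o (o + len)) →
                ∀ j → j ≤ len → Caught o (o + len) ⊎ InSubtree r c (robber (o + j))
      trapped q c o len a rc lazy in-c at-q zero _ = inj₂ (subst (λ z → InSubtree r c (robber z)) (sym (+-identityʳ o)) in-c)
      trapped q c o len a rc lazy in-c at-q (suc j) le with trapped q c o len a rc lazy in-c at-q j (≤-trans (n≤1+n j) le)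
      ... | inj₁ caught = inj₁ caught
      ... | inj₂ inside with lazy (o + j) (m≤m+n o j) (subst (_≤ o + len) (+-suc o j) (+-monoʳ-≤ o le))
      ...   | inj₁ stays = inj₂ (subst (InSubtree r c) (trans stays (cong robber (sym (+-suc o j)))) inside)
      ...   | inj₂ moves with InSubtree? r c (robber (suc (o + j)))
      ...     | yes inside′ = inj₂ (subst (λ z → InSubtree r c (robber z)) (sym (+-suc o j)) inside′)
      ...     | no outside with InSubtree-exit r inside moves outside
      ...       | refl , rc′ = inj₁ (at-q (suc (o + j)) (≤-trans (m≤m+n o j) (n≤1+n _)) (subst (_≤ o + len) (+-suc o j) (+-monoʳ-≤ o le))
                                   (parent-unique r moves (trans (adj-sym c q) a) rc′ rc))

      -- The robber stays trapped in the subtree of c until the excursion into c, and is then caught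
      -- by induction on b.
      mutual
        excursion-catches : ∀ b q ws c → b ≤ ρ → c ∈ ws → adj q c ≡ true → dist r c ≡ suc (dist r q) →
                            (∀ x → InSubtree r c x → dist c x ≤ ρ + b) →
                            ∀ o → (∀ j → j ≤ tours-length b q ws → p (o + j) ≡ tours b q ws j) →
                            LazyOn o (o + tours-length b q ws) → InSubtree r c (robber o) →
                            (∀ t → o ≤ t → t ≤ o + tours-length b q ws → robber t ≡ q → Caught o (o + tours-length b q ws)) →
                            Caught o (o + tours-length b q ws)
        excursion-catches b q ws c b≤ρ c∈ a rc depth o follows lazy in-c at-q =
          finish (trapped q c o T a rc lazy in-c at-q (o′ + 1) (≤-trans (+-monoʳ-≤ o′ (s≤s z≤n)) bound))
          where
          T = tours-length b q ws
          located = excursion-in-tours b q ws c c∈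
          o′ = proj₁ located
          bound : o′ + excursion-length b q c ≤ T
          bound = proj₁ (proj₂ located)
          Tc = tour-length b c q
          shift-by : ∀ (o o′ j : ℕ) → o + (o′ + 1) + j ≡ o + (o′ + (1 + j))
          shift-by = solve-∀
          follows-c : ∀ j → j ≤ Tc → p (o + (o′ + 1) + j) ≡ tour b c q j
          follows-c j le = trans (cong p (shift-by o o′ j))
            (trans (follows (o′ + (1 + j)) (≤-trans (+-monoʳ-≤ o′ (s≤s (≤-trans le (n≤1+n Tc)))) bound))
              (trans (proj₂ (proj₂ located) (suc j) (s≤s (≤-trans le (n≤1+n Tc)))) (excursion-inner b q c j le)))
          within : o + (o′ + 1) + Tc ≤ o + T
          within = ≤-trans (≤-reflexive (shift-by o o′ Tc)) (+-monoʳ-≤ o (≤-trans (+-monoʳ-≤ o′ (n≤1+n (1 + Tc))) bound))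
          finish : Caught o (o + T) ⊎ InSubtree r c (robber (o + (o′ + 1))) → Caught o (o + T)
          finish (inj₁ caught) = caught
          finish (inj₂ in-c′) = Caught-mono (m≤m+n o _) within
            (tour-catches b c q b≤ρ rc depth (o + (o′ + 1)) follows-c (LazyOn-mono (m≤m+n o _) within lazy) in-c′)

        tour-catches : ∀ b q par → b ≤ ρ → dist r q ≡ suc (dist r par) → (∀ x → InSubtree r q x → dist q x ≤ ρ + b) →
                       ∀ o → (∀ j → j ≤ tour-length b q par → p (o + j) ≡ tour b q par j) → LazyOn o (o + tour-length b q par) →
                       InSubtree r q (robber o) → Caught o (o + tour-length b q par)
        tour-catches zero q par b≤ρ rq depth o follows lazy in-q =
          inj₁ (o , ≤-refl , m≤m+n o 0 , subst (λ z → dist z (robber o) ≤ ρ) (sym (trans (cong p (sym (+-identityʳ o))) (follows 0 z≤n)))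
                                           (≤-trans (depth (robber o) in-q) (≤-reflexive (+-identityʳ ρ))))
        tour-catches (suc b) q par b≤ρ rq depth o follows lazy in-q with robber o ≟ᵛ q
        ... | yes at-q′ = caught-here o ≤-refl (m≤m+n o _)
                            (trans (trans (cong p (sym (+-identityʳ o))) (trans (follows 0 z≤n) (tour-start (suc b) q par))) (sym at-q′))
        ... | no not-q = descend (InSubtree-descend r in-q not-q)
          where
          T = tour-length (suc b) q par
          at-q : ∀ t → o ≤ t → t ≤ o + T → robber t ≡ q → Caught o (o + T)
          at-q t o≤t t≤ robber≡q with ≤-split o≤t
          ... | j , refl = inj₁ (o + j , o≤t , t≤ , (begin
            dist (p (o + j)) (robber (o + j))    ≡⟨ trans (cong (dist (p (o + j))) robber≡q) (dist-sym _ _) ⟩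
            dist q (p (o + j))                   ≡⟨ cong (dist q) (follows j j≤) ⟩
            dist q (tour (suc b) q par j)        ≤⟨ tour-dist (suc b) q par j j≤ ⟩
            suc b                                ≤⟨ b≤ρ ⟩
            ρ                                    ∎))
            where
            open ≤-Reasoning
            j≤ = +-cancelˡ-≤ o j T t≤
          descend : (Σ (V G) λ c → adj q c ≡ true × dist r c ≡ suc (dist r q) × InSubtree r c (robber o)) → Caught o (o + T)
          descend (c , a , rc , in-c) =
            excursion-catches b q (children q (par ∷ [])) c (≤-trans (n≤1+n b) b≤ρ) (child∈children q (par ∷ []) a c∉) a rc depth-c
              o follows lazy in-c at-q
            where
            c∉ : c ∉ par ∷ []
            c∉ (here refl) = m≢1+n+m (dist r par) {1} (trans rc (cong suc rq))
            depth-c : ∀ x → InSubtree r c x → dist c x ≤ ρ + b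
            depth-c x in-c′ with InSubtree-child r a rc in-c′
            ... | in-q′ , qx = ≤-pred (subst₂ _≤_ qx (+-suc ρ b) (depth x in-q′))

      -- Of two consecutive cop positions, the one closer to q is within ρ of it.
      caught-at-centre : ∀ q o len → (∀ t → o ≤ t → t ≤ o + len → dist q (p t) ≤ suc ρ) →
                         (∀ t → o ≤ t → t < o + len → adj (p t) (p (suc t)) ≡ true) → p (o + len) ≡ q →
                         ∀ t → o ≤ t → t ≤ o + len → robber t ≡ q → Caught o (o + len)
      caught-at-centre q o len near steps end t o≤t t≤ at-q with m≤n⇒m<n∨m≡n t≤
      ... | inj₂ refl = caught-here (o + len) o≤t t≤ (trans end (sym at-q))
      ... | inj₁ t< with adjacent-levels q (steps t o≤t t<)
      ...   | inj₁ farther = inj₁ (t , o≤t , t≤ , ≤-trans (≤-reflexive (trans (cong (dist (p t)) at-q) (dist-sym _ _)))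
                                                   (≤-pred (subst (_≤ suc ρ) farther (near (suc t) (m≤n⇒m≤1+n o≤t) t<))))
      ...   | inj₂ closer = inj₂ (t , o≤t , t< , ≤-trans (≤-reflexive (trans (cong (dist (p (suc t))) at-q) (dist-sym _ _)))
                                                 (≤-pred (subst (_≤ suc ρ) closer (near t o≤t t≤))))

    module SpinePatrol {ρ : ℕ} (no-legs : ∀ v → ¬ ThreeLegs v (suc (ρ + ρ))) {x₀ y₀ : V G} (a₀ : adj x₀ y₀ ≡ true) where

      open LongestPath a₀

      side-children : ℕ → List (V G)
      side-children i = children (spine i) (spine (i ∸ 1) ∷ spine (suc i) ∷ [])

      side-tours : ℕ → Path
      side-tours i = tours ρ (spine i) (side-children i)

      side-length : ℕ → ℕ
      side-length i = tours-length ρ (spine i) (side-children i)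

      side-end : ∀ i → side-tours i (side-length i) ≡ spine i
      side-end i = tours-end ρ (spine i) (side-children i)

      side-adjacent : ∀ i → Adjacent (side-tours i) (side-length i)
      side-adjacent i = tours-adjacent ρ (spine i) (side-children i) (children-adj (spine i) _)

      sweep : ℕ → ℕ → Path
      sweep zero i = side-tours i
      sweep (suc k) i = append (side-tours i) (side-length i) (cons (spine i) (sweep k (suc i)))

      sweep-length : ℕ → ℕ → ℕ
      sweep-length zero i = side-length i
      sweep-length (suc k) i = side-length i + suc (sweep-length k (suc i))

      sweep-start : ∀ k i → sweep k i 0 ≡ spine i
      sweep-start zero i = tours-start ρ (spine i) (side-children i)
      sweep-start (suc k) i = trans (append-≤ (side-tours i) (side-length i) _ 0 z≤n (side-end i)) (sweep-start zero i)

      sweep-adjacent : ∀ k i → i + k ≡ L → Adjacent (sweep k i) (sweep-length k i)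
      sweep-adjacent zero i _ = side-adjacent i
      sweep-adjacent (suc k) i i+k≡L =
        Adjacent-append (side-tours i) (side-length i) (cons (spine i) (sweep k (suc i))) (suc (sweep-length k (suc i)))
          (side-adjacent i) next (side-end i)
        where
        next : Adjacent (cons (spine i) (sweep k (suc i))) (suc (sweep-length k (suc i)))
        next zero _ = subst (λ z → adj (spine i) z ≡ true) (sym (sweep-start k (suc i)))
                        (spine-adjacent i (subst (suc i ≤_) i+k≡L (subst (_≤ i + suc k) (+-comm i 1) (+-monoʳ-≤ i (s≤s z≤n)))))
        next (suc j) (s≤s lt) = sweep-adjacent k (suc i) (trans (sym (+-suc i k)) i+k≡L) j lt

      abstract
        patrol : Path
        patrol = sweep L 0

        patrol-sweep : ∀ j → patrol j ≡ sweep L 0 j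
        patrol-sweep j = refl

      patrol-length : ℕ
      patrol-length = sweep-length L 0

      patrol-lazy : IsLazyWalk G patrol-length patrol
      patrol-lazy i lt = inj₂ (subst₂ (λ x y → adj x y ≡ true) (sym (patrol-sweep i)) (sym (patrol-sweep (suc i)))
                                  (sweep-adjacent L 0 refl i lt))

      spine-end-childless : ∀ c → adj (spine L) c ≡ true → ¬ dist r c ≡ suc (dist r (spine L))
      spine-end-childless c a rc = <-irrefl refl (spine-maximal (extend spine L c) (suc L)
        (Adjacent-extend spine L c spine-adjacent a) (NonBacktracking-extend spine L c spine-nb not-back))
        where
        not-back : ∀ b → L ≡ suc b → spine b ≢ c
        not-back b L≡ e = m≢1+n+m b {1} (trans (sym (spine-dist b (subst (b ≤_) (sym L≡) (n≤1+n b))))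
                            (trans (cong (dist r) e) (trans rc (cong suc (trans (spine-dist L ≤-refl) L≡)))))

      child-not-back : ∀ i c → i ≤ L → dist r c ≡ suc (dist r (spine i)) → c ≢ spine (i ∸ 1)
      child-not-back i c i≤L rc e = <⇒≱ (s≤s (m∸n≤m i 1))
        (≤-reflexive (trans (sym (trans rc (cong suc (spine-dist i i≤L)))) (trans (cong (dist r) e) (spine-dist (i ∸ 1) (≤-trans (m∸n≤m i 1) i≤L)))))

      module Catch (robber : ℕ → V G) where

        open Pursuit ρ r patrol robber

        Follows : ℕ → Path → ℕ → Set
        Follows o f len = ∀ j → j ≤ len → patrol (o + j) ≡ f j

        side-catches-at-spine : ∀ i o → Follows o (side-tours i) (side-length i) →
                                ∀ t → o ≤ t → t ≤ o + side-length i → robber t ≡ spine i → Caught o (o + side-length i)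
        side-catches-at-spine i o follows = caught-at-centre (spine i) o (side-length i) near steps
          (trans (follows _ ≤-refl) (side-end i))
          where
          near : ∀ t → o ≤ t → t ≤ o + side-length i → dist (spine i) (patrol t) ≤ suc ρ
          near t o≤t t≤ with ≤-split o≤t
          ... | j , refl = subst (λ z → dist (spine i) z ≤ suc ρ) (sym (follows j j≤))
                             (tours-dist ρ (spine i) (side-children i) (children-adj (spine i) _) j j≤)
            where
            j≤ = +-cancelˡ-≤ o j _ t≤
          steps : ∀ t → o ≤ t → t < o + side-length i → adj (patrol t) (patrol (suc t)) ≡ true
          steps t o≤t t< with ≤-split o≤t
          ... | j , refl = subst₂ (λ x y → adj x y ≡ true) (sym (follows j (<⇒≤ j<)))
                             (sym (trans (cong patrol (sym (+-suc o j))) (follows (suc j) j<)))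
                             (side-adjacent i j j<)
            where
            j< = +-cancelˡ-< o j _ t<

        module Sweep-step (k i o : ℕ) (follows : Follows o (sweep (suc k) i) (sweep-length (suc k) i)) where

          follows-side : Follows o (side-tours i) (side-length i)
          follows-side j le = trans (follows j (≤-trans le (m≤m+n _ _))) (append-≤ (side-tours i) (side-length i) (cons (spine i) (sweep k (suc i))) j le (side-end i))

          side-within : o + side-length i ≤ o + sweep-length (suc k) i
          side-within = +-monoʳ-≤ o (m≤m+n _ _)

          side-catches : ∀ c → i ≤ L → adj (spine i) c ≡ true → dist r c ≡ suc (dist r (spine i)) → c ≢ spine (suc i) →
                         LazyOn o (o + sweep-length (suc k) i) → InSubtree r c (robber o) → Caught o (o + sweep-length (suc k) i)
          side-catches c i≤L a rc not-next lazy in-c = Caught-mono ≤-refl side-within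
            (excursion-catches ρ (spine i) (side-children i) c ≤-refl c∈ a rc depth-c o follows-side
              (LazyOn-mono ≤-refl side-within lazy) in-c (side-catches-at-spine i o follows-side))
            where
            c∈ : c ∈ side-children i
            c∈ = child∈children (spine i) _ a λ { (here e) → child-not-back i c i≤L rc e ; (there (here e)) → not-next e }
            depth-c : ∀ x → InSubtree r c x → dist c x ≤ ρ + ρ
            depth-c x in-c′ = ≤-pred (side-depth no-legs i i≤L c a rc not-next x in-c′)

          step-to-next : LazyOn o (o + sweep-length (suc k) i) → InSubtree r (spine (suc i)) (robber (o + side-length i)) →
                         (InSubtree r (spine (suc i)) (robber (o + suc (side-length i))) → Caught o (o + sweep-length (suc k) i)) →
                         Caught o (o + sweep-length (suc k) i)
          step-to-next lazy ahead continue = robber-moves (lazy t (m≤m+n o _) t<)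
            where
            t = o + side-length i
            Ls<  : suc (side-length i) ≤ sweep-length (suc k) i
            Ls< = ≤-trans (s≤s (m≤m+n _ _)) (≤-reflexive (sym (+-suc _ _)))
            t< : t < o + sweep-length (suc k) i
            t< = +-monoʳ-< o Ls<
            cop-next : patrol (suc t) ≡ spine (suc i)
            cop-next = trans (cong patrol (sym (+-suc o _))) (trans (follows _ Ls<)
                         (trans (cong (sweep (suc k) i) (+-comm 1 _)) (trans (append-+ (side-tours i) (side-length i) (cons (spine i) (sweep k (suc i))) 1) (sweep-start k (suc i)))))
            continue′ : InSubtree r (spine (suc i)) (robber (suc t)) → Caught o (o + sweep-length (suc k) i)
            continue′ in-next = continue (subst (λ z → InSubtree r (spine (suc i)) (robber z)) (sym (+-suc o _)) in-next)
            robber-moves : robber t ≡ robber (suc t) ⊎ adj (robber t) (robber (suc t)) ≡ true → Caught o (o + sweep-length (suc k) i)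
            robber-moves (inj₁ stays) = continue′ (subst (InSubtree r (spine (suc i))) stays ahead)
            robber-moves (inj₂ moves) with InSubtree? r (spine (suc i)) (robber (suc t))
            ... | yes still = continue′ still
            ... | no left = inj₂ (t , m≤m+n o _ , t< ,
                    ≤-trans (≤-reflexive (trans (cong₂ dist cop-next (proj₁ (InSubtree-exit r ahead moves left))) (dist-refl _))) z≤n)

        sweep-catches : ∀ k i → i + k ≡ L → ∀ o → Follows o (sweep k i) (sweep-length k i) → LazyOn o (o + sweep-length k i) →
                        InSubtree r (spine i) (robber o) → Caught o (o + sweep-length k i)
        sweep-catches k i i+k≡L o follows lazy in-i with robber o ≟ᵛ spine i
        ... | yes at-i = caught-here o ≤-refl (m≤m+n o _)
                           (trans (trans (cong patrol (sym (+-identityʳ o))) (trans (follows 0 z≤n) (sweep-start k i))) (sym at-i))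
        ... | no not-i with InSubtree-descend r in-i not-i | k
        ...   | c , a , rc , in-c | zero = ⊥-elim (spine-end-childless c (subst (λ z → adj (spine z) c ≡ true) i≡L a)
                                                    (subst (λ z → dist r c ≡ suc (dist r (spine z))) i≡L rc))
          where
          i≡L = trans (sym (+-identityʳ i)) i+k≡L
        ...   | c , a , rc , in-c | suc k′ with c ≟ᵛ spine (suc i)
        ...     | no not-next = Sweep-step.side-catches k′ i o follows c (subst (i ≤_) i+k≡L (m≤m+n i _)) a rc not-next lazy in-c
        ...     | yes refl with trapped (spine i) (spine (suc i)) o (side-length i) a rc (LazyOn-mono ≤-refl (Sweep-step.side-within k′ i o follows) lazy)
                                  in-c (side-catches-at-spine i o (Sweep-step.follows-side k′ i o follows)) (side-length i) ≤-refl
        ...       | inj₁ caught = Caught-mono ≤-refl (Sweep-step.side-within k′ i o follows) caught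
        ...       | inj₂ ahead = Sweep-step.step-to-next k′ i o follows lazy ahead continue
          where
          realign : ∀ (o Ls j : ℕ) → o + suc Ls + j ≡ o + (Ls + suc j)
          realign = solve-∀
          continue : InSubtree r (spine (suc i)) (robber (o + suc (side-length i))) → Caught o (o + sweep-length (suc k′) i)
          continue in-next = subst (Caught o) (realign o _ _) (Caught-mono (m≤m+n o _) ≤-refl
            (sweep-catches k′ (suc i) (trans (sym (+-suc i k′)) i+k≡L) (o + suc (side-length i))
              (λ j le → trans (cong patrol (realign o _ j))
                          (trans (follows (side-length i + suc j) (+-monoʳ-≤ (side-length i) (s≤s le))) (append-+ (side-tours i) (side-length i) (cons (spine i) (sweep k′ (suc i))) (suc j))))
              (LazyOn-mono (m≤m+n o _) (≤-reflexive (realign o _ _)) lazy) in-next))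

      cop-wins : CopWins G ρ
      cop-wins = patrol-length , patrol , patrol-lazy , λ robber lazy →
        captured robber (Catch.sweep-catches robber L 0 refl 0 (λ j _ → patrol-sweep j) (λ i _ lt → lazy i lt) (InSubtree-root r (robber 0)))
        where
        captured : ∀ robber → Pursuit.Caught ρ r patrol robber 0 patrol-length → Captures G ρ patrol-length patrol robber
        captured robber (inj₁ (i , _ , i≤ , close)) = inj₁ (i , i≤ , dist⇒Close close)
        captured robber (inj₂ (i , _ , i< , close)) = inj₂ (i , i< , dist⇒Close close)

    <ℓ₃⇒ThreeLegs : ∀ v k → k < ℓ₃ v → ThreeLegs v k
    <ℓ₃⇒ThreeLegs v k lt with ℓ₃ v in e
    ... | zero = ⊥-elim (n≮0 lt)
    ... | suc j = ThreeLegs-≤ (≤-pred lt) (ℓ₃-legs v j e)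

    cop-wins : ∀ ρ → (∀ v → ¬ ThreeLegs v (suc (ρ + ρ))) → CopWins G ρ
    cop-wins ρ no-legs with any? (λ x → any? λ y → adj x y ≟ᵇ true)
    ... | yes (x , y , a) = SpinePatrol.cop-wins {ρ} no-legs a
    ... | no no-edge = 0 , (λ _ → v) , (λ i ()) , λ robber _ → inj₁ (0 , z≤n , 0 , z≤n , subst (λ w → Walk G (full G) v w 0) (single (robber 0)) (here refl))
      where
      v = proj₁ (proj₁ tree)
      single : ∀ w → v ≡ w
      single w with connected v w refl refl
      ... | _ , here _ = refl
      ... | _ , step {w = y} _ a _ = ⊥-elim (no-edge (v , y , a))

    robber-wins : ∀ ρ v → ThreeLegs v (suc (ρ + ρ)) → ¬ CopWins G ρ
    robber-wins ρ v legs (m , p , lazy , wins) = robber-safe (wins robber robber-lazy)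
      where open RobberEscapes {ρ} legs lazy

theorem4 : (T : Graph) → IsTree T → Σ ℕ (λ M → IsMaxHalfL3 T M × RhoIs T M)
theorem4 T tree = M , (below , peak , ℓ₃ T tree peak , ℓ₃-IsL3 T tree peak , refl) , cop-wins T tree M no-legs , minimal
  where
  half-ℓ₃ : V T → ℕ
  half-ℓ₃ v = ℓ₃ T tree v / 2
  peak = argmax half-ℓ₃ (proj₁ (proj₁ tree)) (allFin (Graph.n T))
  M = half-ℓ₃ peak
  peak-max : ∀ v → half-ℓ₃ v ≤ M
  peak-max v = All.lookup (f[xs]≤f[argmax] {f = half-ℓ₃} (proj₁ (proj₁ tree)) (allFin (Graph.n T))) (∈-allFin v)
  below : ∀ v k → IsL3 T v k → k / 2 ≤ M
  below v k is-ℓ₃ = ≤-trans (/-monoˡ-≤ 2 (IsL3⇒≤ℓ₃ T tree v k is-ℓ₃)) (peak-max v)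
  no-legs : ∀ v → ¬ ThreeLegs T tree v (suc (M + M))
  no-legs v legs = <⇒≱ (2+2m≤n⇒m<n/2 (ThreeLegs⇒<ℓ₃ T tree v _ legs)) (peak-max v)
  minimal : ∀ ρ → CopWins T ρ → M ≤ ρ
  minimal ρ wins = ≮⇒≥ λ ρ<M → robber-wins T tree ρ peak (<ℓ₃⇒ThreeLegs T tree peak _ (m<n/2⇒2+2m≤n ρ<M)) wins
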